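{- Let $d>1$ be an integer, $q$ a prime power with $q\equiv 1\pmod d$, and $\omega\in\mathbb{F}_q$ a primitive $d$-th root of unity. For $0\le i\le d-1$ let $$A_i(x)=x^{q^{d-1}}+\omega^i x^{q^{d-2}}+\cdots+\omega^{i(d-1)}x=\sum_{k=0}^{d-1}\omega^{ik}x^{q^{d-1-k}}.$$ Let $m_0,\dots,m_{d-1}$ be positive integers and $u_0,\dots,u_{d-1}\in\mathbb{F}_q$. Then the polynomial $$f(x)=\sum_{i=0}^{d-1}u_iA_i(x)^{m_i}$$ is a permutation polynomial of $\mathbb{F}_{q^d}$ if and only if $\{im_i:0\le i\le d-1\}$ is a complete residue system modulo $d$, $u_0\cdots u_{d-1}\in\mathbb{F}_q^\ast$, and $\gcd(m_0\cdots m_{d-1},q-1)=1$. Furthermore, if $f$ is a permutation polynomial of $\mathbb{F}_{q^d}$ and $r_0,\dots,r_{d-1}$ are positive integers with $m_ir_i\equiv 1\pmod{d(q-1)}$, then the compositional inverse of $f$ on $\mathbb{F}_{q^d}$ is $$f^{ -1}(x)=\frac1d\sum_{i=0}^{d-1}\omega^i\,(du_i\omega^{ -j_i})^{ -r_i}A_{j_i}(x)^{r_i},$$ where for each $i$, $j_i\in\{0,\dots,d-1\}$ is the integer with $j_i\equiv im_i\pmod d$.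
   Context: A polynomial $f\in\mathbb{F}_Q[x]$ is a permutation polynomial of $\mathbb{F}_Q$ if $a\mapsto f(a)$ is a bijection of $\mathbb{F}_Q$; its compositional inverse is the (polynomial representing the) inverse map. -}

module Defs where

open import Level using (Level; _⊔_) renaming (suc to lsuc)
open import Algebra.Bundles using (CommutativeRing; Semiring)
open import Data.Nat using (ℕ; zero; suc; NonZero)
import Data.Nat as N
open import Data.Nat.DivMod using (_mod_)
open import Data.Nat.Primality using (Prime)
open import Data.Fin using (Fin; toℕ; fromℕ)
open import Data.Product using (Σ; ∃; _×_; _,_)
open import Relation.Binary.PropositionalEquality using (_≡_)
open import Relation.Nullary using (¬_)
open import Function.Definitions using (Bijective)
import Algebra.Definitions.RawSemiring as RS

-- The inverse is given as a total,
-- congruent function (its value at 0 is irrelevant / unconstrained).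
record Field (c ℓ : Level) : Set (lsuc (c ⊔ ℓ)) where
  field
    commutativeRing : CommutativeRing c ℓ
  open CommutativeRing commutativeRing public
  field
    _⁻¹      : Carrier → Carrier
    ⁻¹-cong  : ∀ {x y} → x ≈ y → x ⁻¹ ≈ y ⁻¹
    1≉0      : ¬ (1# ≈ 0#)
    ⁻¹-inverse : ∀ x → ¬ (x ≈ 0#) → x * (x ⁻¹) ≈ 1#
  open RS (Semiring.rawSemiring semiring) public using (_^_; sum; product) renaming (_×_ to _⊗_)

IsPrimePower : ℕ → Set
IsPrimePower q = Σ ℕ λ p → Σ ℕ λ n → Prime p × 1 N.≤ n × q ≡ p N.^ n

∏ℕ : ∀ {n} → (Fin n → ℕ) → ℕ
∏ℕ {zero}  a = 1
∏ℕ {suc n} a = a Fin.zero N.* ∏ℕ (λ i → a (Fin.suc i))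
  where import Data.Fin as Fin

CompleteResidueSystem : (d : ℕ) .{{_ : NonZero d}} → (Fin d → ℕ) → Set
CompleteResidueSystem d a =
  Bijective _≡_ _≡_ (λ (i : Fin d) → a i mod d)

module _ {c ℓ} (K : Field c ℓ) where
  open Field K

  -- a ∈ F_q (the subfield of order q of F_{q^d}) iff a^q = a
  InSubfield : ℕ → Carrier → Set ℓ
  InSubfield q a = a ^ q ≈ a

  PrimitiveRoot : ℕ → Carrier → Set ℓ
  PrimitiveRoot d ω = (ω ^ d ≈ 1#) × (∀ k → 0 N.< k → k N.< d → ¬ (ω ^ k ≈ 1#))

  Apoly : (q d : ℕ) → Carrier → ℕ → Carrier → Carrier
  Apoly q d ω i x =
    sum {d} (λ k → (ω ^ (i N.* toℕ k)) * (x ^ (q N.^ (d N.∸ 1 N.∸ toℕ k))))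

  fpoly : (q d : ℕ) → Carrier → (Fin d → ℕ) → (Fin d → Carrier) → Carrier → Carrier
  fpoly q d ω m u x = sum {d} (λ i → u i * (Apoly q d ω (toℕ i) x ^ m i))

  jIndex : (d : ℕ) .{{_ : NonZero d}} → (Fin d → ℕ) → Fin d → ℕ
  jIndex d m i = toℕ ((toℕ i N.* m i) mod d)

  finvpoly : (q d : ℕ) .{{_ : NonZero d}} → Carrier → (Fin d → ℕ) → (Fin d → Carrier)
           → (Fin d → ℕ) → Carrier → Carrier
  finvpoly q d ω m u r x =
    ((d ⊗ 1#) ⁻¹) * sum {d} (λ i →
      (ω ^ toℕ i)
      * (((((d ⊗ 1#) * u i) * ((ω ⁻¹) ^ jIndex d m i)) ⁻¹) ^ r i)
      * (Apoly q d ω (jIndex d m i) x ^ r i))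

  IsPermutation : (Carrier → Carrier) → Set (c ⊔ ℓ)
  IsPermutation g = Bijective _≈_ _≈_ g

{-# OPTIONS --safe #-}
-- Let Eₛ = {y : y^q = ωˢ y} be the eigenspaces of the q-Frobenius on F_{q^d}.  Every Aᵢ maps into
-- Eᵢ and acts on Eₛ as multiplication by h(ωⁱ, ωˢ) = Σₖ ω^(ik) ω^(s(d-1-k)), which is d ω^(-i) if
-- i = s and 0 otherwise; moreover Σᵢ ωⁱ Aᵢ(x) = d x.  Since uᵢ Aᵢ(x)^mᵢ ∈ E_(i mᵢ), this gives
-- A_j(f(x)) = d ω^(-j) Σ_{jᵢ = j} uᵢ Aᵢ(x)^mᵢ.  If the jᵢ are distinct, all uᵢ ≠ 0 and
-- gcd(mᵢ, q - 1) = 1, then x is recovered from f(x), since y ↦ y^mᵢ is injective on Eᵢ (where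
-- y^(q-1) = ωⁱ for y ≠ 0); raising to the rᵢ-th powers instead gives the inverse.  Conversely, a
-- residue j missed by the jᵢ makes A_j ∘ f vanish although A_j is nonzero on E_j ≠ 0; uᵢ = 0 makes
-- f vanish on Eᵢ; and a root of unity ζ ≠ 1 whose order divides gcd(mᵢ, q - 1) gives f(ζ y) = f(y)
-- on Eᵢ.  The finite-field facts used (x^(q^d) = x, additivity of y ↦ y^q, nonroots of polynomials
-- of degree < q^d) are derived from the enumeration of the field by Fin (q^d).
module Submission where

open import Defs
open import Data.Nat using (ℕ; NonZero; _<_; _∸_; _%_) renaming (_*_ to _*ℕ_; _^_ to _^ℕ_)
open import Data.Nat.GCD using (gcd)
open import Data.Nat.Divisibility using (_∣_)
open import Data.Fin using (Fin; toℕ)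
open import Data.Product using (_×_)
open import Relation.Binary.PropositionalEquality using (_≡_; setoid)
open import Relation.Nullary using (¬_)
open import Function.Bundles using (Inverse; _⇔_)

open import Level using (_⊔_)
open import Data.Nat as ℕ using (zero; suc)
import Data.Nat.Properties as ℕ
open import Data.Nat.DivMod using (_/_; _mod_; m≡m%n+[m/n]*n; m%n<n)
open import Data.Nat.Divisibility using (divides)
open import Data.Nat.GCD using (module Bézout; gcd[m,n]∣m; gcd[m,n]∣n; gcd[m,n]≡0⇒n≡0)
open import Data.Nat.Coprimality using (coprime-Bézout; gcd≡1⇒coprime; coprime⇒gcd≡1)
open import Data.Nat.Primality using (Prime)
open import Data.Nat.Combinatorics using (_C_; nCn≡1; nCk≡nC[n∸k])
open import Data.Fin as F using ()
import Data.Fin.Properties as FP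
open import Data.Fin.Permutation using (Permutation; permutation)
open import Data.Product using (Σ; _,_; proj₁; proj₂)
open import Data.Empty using (⊥; ⊥-elim)
open import Relation.Nullary using (yes; no)
open import Relation.Binary using (tri<; tri≈; tri>)
open import Relation.Binary.Definitions using (Decidable)
open import Relation.Binary.PropositionalEquality as ≡ using (_≢_)
open import Function.Base using (_∘_)
open import Function.Bundles using (mk⇔)
open import Function.Definitions using (Surjective)

module Arithmetic where
  open import Data.Nat
  open import Data.Nat.Properties
  open import Data.Nat.Divisibility
  open import Data.Nat.DivMod using (m/n*n≡m)
  open import Data.Nat.Primality
  open import Data.Nat.Combinatorics using (nCk≡n!/k![n-k]!; k![n∸k]!∣n!)
  open import Data.Nat.GCD using (gcd-greatest)
  open import Data.Nat.Coprimality using (Coprime; coprime-divisor; 1-coprimeTo)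
  open import Data.Nat.Tactic.RingSolver using (solve-∀)
  open import Data.Fin using (punchOut)
  open import Data.Sum using (inj₁; inj₂)
  open import Relation.Binary.PropositionalEquality

  1<prime : ∀ {p} → Prime p → 1 < p
  1<prime {suc (suc p)} _ = s≤s (s≤s z≤n)

  prime∤! : ∀ {p} → Prime p → ∀ m → m < p → ¬ p ∣ m !
  prime∤! pr zero m<p p∣1 = <⇒≱ (1<prime pr) (∣⇒≤ p∣1)
  prime∤! pr (suc m) m<p p∣m! with euclidsLemma (suc m) (m !) pr p∣m!
  ... | inj₁ p∣1+m = <⇒≱ m<p (∣⇒≤ p∣1+m)
  ... | inj₂ p∣m!′ = prime∤! pr m (<-trans (n<1+n m) m<p) p∣m!′

  nCk*k!*[n∸k]!≡n! : ∀ {n k} → k ≤ n → (n C k) * (k ! * (n ∸ k) !) ≡ n !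
  nCk*k!*[n∸k]!≡n! {n} {k} k≤n =
    trans (cong (_* (k ! * (n ∸ k) !)) (nCk≡n!/k![n-k]! k≤n))
          (m/n*n≡m {{k !* (n ∸ k) !≢0}} (k![n∸k]!∣n! k≤n))

  prime∣pCk : ∀ {p k} → Prime p → 0 < k → k < p → p ∣ p C k
  prime∣pCk {suc p′} {k} pr 0<k k<p
    with euclidsLemma (suc p′ C k) (k ! * (suc p′ ∸ k) !) pr
           (subst (suc p′ ∣_) (sym (nCk*k!*[n∸k]!≡n! (<⇒≤ k<p))) (m∣m*n (p′ !)))
  ... | inj₁ p∣C = p∣C
  ... | inj₂ p∣k!*[p∸k]! with euclidsLemma (k !) ((suc p′ ∸ k) !) pr p∣k!*[p∸k]!
  ...   | inj₁ p∣k! = ⊥-elim (prime∤! pr k k<p p∣k!)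
  ...   | inj₂ p∣[p∸k]! = ⊥-elim (prime∤! pr (suc p′ ∸ k) (∸-monoʳ-< 0<k (<⇒≤ k<p)) p∣[p∸k]!)

  m≤m^n : ∀ {m n} → 1 ≤ n → 1 ≤ m → m ≤ m ^ n
  m≤m^n {m} {suc n} _ 1≤m =
    subst (_≤ m * m ^ n) (*-identityʳ m) (*-monoʳ-≤ m (^-monoʳ-≤ m {{>-nonZero 1≤m}} (z≤n {n})))

  m∣m^n : ∀ {m n} → 1 ≤ n → m ∣ m ^ n
  m∣m^n {m} {suc n} _ = m∣m*n (m ^ n)

  [1+a]^t≡1+a*c : ∀ a t → 1 ≤ t → Σ ℕ λ c → 1 ≤ c × suc a ^ t ≡ suc (a * c)
  [1+a]^t≡1+a*c a (suc zero) _ = 1 , s≤s z≤n , refl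
  [1+a]^t≡1+a*c a (suc (suc t)) _ with [1+a]^t≡1+a*c a (suc t) (s≤s z≤n)
  ... | c , _ , e = suc (suc a * c) , s≤s z≤n , trans (cong (suc a *_) e) (step a c)
    where
      step : ∀ a c → suc a * suc (a * c) ≡ suc (a * suc (suc a * c))
      step = solve-∀

  gcd≡1-∣ : ∀ {a b c} → a ∣ b → gcd b c ≡ 1 → gcd a c ≡ 1
  gcd≡1-∣ {a} {b} {c} a∣b gcd≡1 =
    ∣1⇒≡1 (subst (gcd a c ∣_) gcd≡1 (gcd-greatest (∣-trans (gcd[m,n]∣m a c) a∣b) (gcd[m,n]∣n a c)))

  ∣∏ℕ : ∀ {n} (m : Fin n → ℕ) i → m i ∣ ∏ℕ m
  ∣∏ℕ {suc n} m F.zero = m∣m*n _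
  ∣∏ℕ {suc n} m (F.suc i) = ∣n⇒∣m*n (m F.zero) (∣∏ℕ (λ j → m (F.suc j)) i)

  coprime-* : ∀ {a b c} → Coprime a c → Coprime b c → Coprime (a * b) c
  coprime-* {a} {b} {c} a⊥c b⊥c {e} (e∣ab , e∣c) = b⊥c (coprime-divisor e⊥a e∣ab , e∣c)
    where
      e⊥a : Coprime e a
      e⊥a (x∣e , x∣a) = a⊥c (x∣a , ∣-trans x∣e e∣c)

  coprime-∏ℕ : ∀ {n} (m : Fin n → ℕ) {c} → (∀ i → Coprime (m i) c) → Coprime (∏ℕ m) c
  coprime-∏ℕ {zero} m {c} _ = 1-coprimeTo c
  coprime-∏ℕ {suc n} m m⊥c = coprime-* (m⊥c F.zero) (coprime-∏ℕ (λ j → m (F.suc j)) (λ j → m⊥c (F.suc j)))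

  Fin-injective⇒surjective : ∀ {n} (h : Fin n → Fin n) → (∀ {i j} → h i ≡ h j → i ≡ j) →
                         ∀ y → Σ (Fin n) λ i → h i ≡ y
  Fin-injective⇒surjective {suc n} h inj y with FP.any? (λ i → h i FP.≟ y)
  ... | yes hit = hit
  ... | no miss = ⊥-elim (<⇒≱ (n<1+n n) (FP.injective⇒≤ h′-injective))
    where
      h≢y : ∀ i → y ≢ h i
      h≢y i y≡hi = miss (i , sym y≡hi)
      h′ : Fin (suc n) → Fin n
      h′ i = punchOut (h≢y i)
      h′-injective : ∀ {i j} → h′ i ≡ h′ j → i ≡ j
      h′-injective {i} {j} e = inj (FP.punchOut-injective (h≢y i) (h≢y j) e)

  Fin-surjective⇒injective : ∀ {n} (h : Fin n → Fin n) → (∀ y → Σ (Fin n) λ i → h i ≡ y) →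
                         ∀ {i j} → h i ≡ h j → i ≡ j
  Fin-surjective⇒injective h surj {i} {j} hi≡hj =
    let a , sa≡i = Fin-injective⇒surjective s s-injective i
        b , sb≡j = Fin-injective⇒surjective s s-injective j
        a≡b = begin
          a        ≡⟨ sym (hs a) ⟩
          h (s a)  ≡⟨ cong h sa≡i ⟩
          h i      ≡⟨ hi≡hj ⟩
          h j      ≡⟨ cong h (sym sb≡j) ⟩
          h (s b)  ≡⟨ hs b ⟩
          b        ∎
    in trans (sym sa≡i) (trans (cong s a≡b) sb≡j)
    where
      open ≡-Reasoning
      s : Fin _ → Fin _
      s y = proj₁ (surj y)
      hs : ∀ y → h (s y) ≡ y
      hs y = proj₂ (surj y)
      s-injective : ∀ {a b} → s a ≡ s b → a ≡ b
      s-injective {a} {b} e = trans (sym (hs a)) (trans (cong h e) (hs b))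

  [1+a]^t≡1+M*g : ∀ {a g} t → 1 ≤ t → 1 ≤ a → g ∣ a → Σ ℕ λ M → 1 ≤ M × suc a ^ t ≡ suc (M * g)
  [1+a]^t≡1+M*g {a} {g} t 1≤t 1≤a (divides s a≡s*g) with [1+a]^t≡1+a*c a t 1≤t
  ... | c , 1≤c , [1+a]^t≡1+a*c =
    s * c , *-mono-≤ 1≤s 1≤c , trans [1+a]^t≡1+a*c (cong suc (begin
      a * c             ≡⟨ cong (_* c) a≡s*g ⟩
      s * g * c         ≡⟨ *-assoc s g c ⟩
      s * (g * c)       ≡⟨ cong (s *_) (*-comm g c) ⟩
      s * (c * g)       ≡⟨ *-assoc s c g ⟨
      s * c * g         ∎))
    where
      open ≡-Reasoning
      1≤s : 1 ≤ s
      1≤s = n≢0⇒n>0 λ s≡0 → <⇒≱ 1≤a (≤-reflexive (trans a≡s*g (cong (_* g) s≡0)))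

open Arithmetic

module FieldProperties {c ℓ} (K : Field c ℓ) where
  open Field K
  open import Relation.Binary.Reasoning.Setoid (Field.setoid K)
  open import Algebra.Properties.Semiring.Sum semiring
    using (sum-cong-≋; sum-replicate)
  open import Algebra.Properties.Semiring.Mult semiring using (×-assoc-*; ×-congʳ)
  open import Algebra.Properties.CommutativeSemiring.Exp commutativeSemiring
    using (^-congˡ; ^-congʳ; ^-assocʳ)
  open import Algebra.Properties.CommutativeSemigroup *-commutativeSemigroup
    using (interchange; x∙yz≈y∙xz)
  import Algebra.Properties.Group +-group as AdditiveGroup

  ⁻¹-inverseˡ : ∀ x → ¬ x ≈ 0# → x ⁻¹ * x ≈ 1#
  ⁻¹-inverseˡ x x≉0 = trans (*-comm _ _) (⁻¹-inverse x x≉0)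

  *-cancelˡ : ∀ {x y z} → ¬ x ≈ 0# → x * y ≈ x * z → y ≈ z
  *-cancelˡ {x} {y} {z} x≉0 eq = begin
    y                  ≈⟨ sym (*-identityˡ y) ⟩
    1# * y             ≈⟨ *-congʳ (sym (⁻¹-inverseˡ x x≉0)) ⟩
    (x ⁻¹ * x) * y     ≈⟨ *-assoc _ _ _ ⟩
    x ⁻¹ * (x * y)     ≈⟨ *-congˡ eq ⟩
    x ⁻¹ * (x * z)     ≈⟨ sym (*-assoc _ _ _) ⟩
    (x ⁻¹ * x) * z     ≈⟨ *-congʳ (⁻¹-inverseˡ x x≉0) ⟩
    1# * z             ≈⟨ *-identityˡ z ⟩
    z                  ∎

  *-cancelʳ : ∀ {x y z} → ¬ x ≈ 0# → y * x ≈ z * x → y ≈ z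
  *-cancelʳ x≉0 eq = *-cancelˡ x≉0 (trans (*-comm _ _) (trans eq (*-comm _ _)))

  x*y≈0⇒y≈0 : ∀ {x y} → ¬ x ≈ 0# → x * y ≈ 0# → y ≈ 0#
  x*y≈0⇒y≈0 {x} x≉0 eq = *-cancelˡ x≉0 (trans eq (sym (zeroʳ x)))

  *-≉0 : ∀ {x y} → ¬ x ≈ 0# → ¬ y ≈ 0# → ¬ x * y ≈ 0#
  *-≉0 x≉0 y≉0 xy≈0 = y≉0 (x*y≈0⇒y≈0 x≉0 xy≈0)

  ^-≉0 : ∀ {x} n → ¬ x ≈ 0# → ¬ x ^ n ≈ 0#
  ^-≉0 zero    _   = 1≉0
  ^-≉0 (suc n) x≉0 = *-≉0 x≉0 (^-≉0 n x≉0)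

  ^-≈0 : ∀ {x} n → 1 ℕ.≤ n → x ≈ 0# → x ^ n ≈ 0#
  ^-≈0 (suc n) _ x≈0 = trans (*-congʳ x≈0) (zeroˡ _)

  ⁻¹-≉0 : ∀ {x} → ¬ x ≈ 0# → ¬ x ⁻¹ ≈ 0#
  ⁻¹-≉0 {x} x≉0 x⁻¹≈0 = 1≉0 (trans (sym (⁻¹-inverse x x≉0)) (trans (*-congˡ x⁻¹≈0) (zeroʳ x)))

  x-y≈0⇒x≈y : ∀ {x y} → x - y ≈ 0# → x ≈ y
  x-y≈0⇒x≈y = AdditiveGroup.x∙y⁻¹≈ε⇒x≈y _ _

  x-y+y≈x : ∀ x y → (x - y) + y ≈ x
  x-y+y≈x x y = AdditiveGroup.//-rightDividesˡ y x

  +-cancelʳ : ∀ {x y z} → y + x ≈ z + x → y ≈ z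
  +-cancelʳ = AdditiveGroup.∙-cancelʳ _ _ _

  1^n≈1 : ∀ n → 1# ^ n ≈ 1#
  1^n≈1 zero    = refl
  1^n≈1 (suc n) = trans (*-identityˡ _) (1^n≈1 n)

  ^-comm : ∀ x m n → (x ^ m) ^ n ≈ (x ^ n) ^ m
  ^-comm x m n = trans (^-assocʳ x m n) (trans (^-congʳ x (ℕ.*-comm m n)) (sym (^-assocʳ x n m)))

  ^-* : ∀ x m n → x ^ (m ℕ.* n) ≈ (x ^ n) ^ m
  ^-* x m n = trans (^-congʳ x (ℕ.*-comm m n)) (sym (^-assocʳ x n m))

  xᵍ≈1⇒xᵉ≈1 : ∀ {x g e} → x ^ g ≈ 1# → g ∣ e → x ^ e ≈ 1#
  xᵍ≈1⇒xᵉ≈1 {x} {g} xᵍ≈1 (divides t e≡t*g) =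
    trans (^-congʳ x e≡t*g) (trans (^-* x t g) (trans (^-congˡ t xᵍ≈1) (1^n≈1 t)))

  ×≈×1* : ∀ n x → n ⊗ x ≈ (n ⊗ 1#) * x
  ×≈×1* n x = sym (trans (×-assoc-* n 1# x) (×-congʳ n (*-identityˡ x)))

  sum-cong : ∀ {n} {f g : Fin n → Carrier} → (∀ i → f i ≈ g i) → sum f ≈ sum g
  sum-cong = sum-cong-≋

  sum-≈0 : ∀ {n} (f : Fin n → Carrier) → (∀ i → f i ≈ 0#) → sum f ≈ 0#
  sum-≈0 {zero}  f f≈0 = refl
  sum-≈0 {suc n} f f≈0 = trans (+-cong (f≈0 F.zero) (sum-≈0 (λ i → f (F.suc i)) (λ i → f≈0 (F.suc i)))) (+-identityˡ 0#)

  sum-single : ∀ {n} (f : Fin n → Carrier) i₀ → (∀ i → i ≢ i₀ → f i ≈ 0#) → sum f ≈ f i₀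
  sum-single {suc n} f F.zero f≈0 =
    trans (+-congˡ (sum-≈0 _ (λ i → f≈0 (F.suc i) (λ ())))) (+-identityʳ _)
  sum-single {suc n} f (F.suc i₀) f≈0 =
    trans (+-cong (f≈0 F.zero (λ ()))
                  (sum-single (λ i → f (F.suc i)) i₀ (λ i i≢i₀ → f≈0 (F.suc i) (λ e → i≢i₀ (FP.suc-injective e)))))
          (+-identityˡ _)

  sum-const : ∀ n x → sum {n} (λ _ → x) ≈ n ⊗ x
  sum-const n x = sum-replicate n

  product-cong : ∀ {n} {f g : Fin n → Carrier} → (∀ i → f i ≈ g i) → product f ≈ product g
  product-cong {zero}  eq = refl
  product-cong {suc n} eq = *-cong (eq F.zero) (product-cong (λ i → eq (F.suc i)))

  product-≉0 : ∀ {n} (u : Fin n → Carrier) → (∀ i → ¬ u i ≈ 0#) → ¬ product u ≈ 0#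
  product-≉0 {zero}  u _   = 1≉0
  product-≉0 {suc n} u u≉0 = *-≉0 (u≉0 F.zero) (product-≉0 (λ i → u (F.suc i)) (λ i → u≉0 (F.suc i)))

  product-≈0 : ∀ {n} (u : Fin n → Carrier) i → u i ≈ 0# → product u ≈ 0#
  product-≈0 {suc n} u F.zero    u≈0 = trans (*-congʳ u≈0) (zeroˡ _)
  product-≈0 {suc n} u (F.suc i) u≈0 = trans (*-congˡ (product-≈0 (λ j → u (F.suc j)) i u≈0)) (zeroʳ _)

  product-scale : ∀ {n} x (f : Fin n → Carrier) → product (λ i → x * f i) ≈ x ^ n * product f
  product-scale {zero}  x f = sym (*-identityˡ _)
  product-scale {suc n} x f = begin
    (x * f F.zero) * product (λ i → x * f (F.suc i))           ≈⟨ *-congˡ (product-scale x (λ i → f (F.suc i))) ⟩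
    (x * f F.zero) * (x ^ n * product (λ i → f (F.suc i)))     ≈⟨ interchange x (f F.zero) (x ^ n) _ ⟩
    (x * x ^ n) * (f F.zero * product (λ i → f (F.suc i)))     ∎

  product-agree-except : ∀ {n} (h h′ : Fin n → Carrier) i₀ → (∀ i → i ≢ i₀ → h i ≈ h′ i) →
                         h′ i₀ * product h ≈ h i₀ * product h′
  product-agree-except {suc n} h h′ F.zero eq = begin
    h′ F.zero * (h F.zero * product (λ i → h (F.suc i)))    ≈⟨ x∙yz≈y∙xz _ _ _ ⟩
    h F.zero * (h′ F.zero * product (λ i → h (F.suc i)))    ≈⟨ *-congˡ (*-congˡ (product-cong (λ i → eq (F.suc i) (λ ())))) ⟩
    h F.zero * (h′ F.zero * product (λ i → h′ (F.suc i)))   ∎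
  product-agree-except {suc n} h h′ (F.suc i₀) eq = begin
    h′ (F.suc i₀) * (h F.zero * product (λ i → h (F.suc i)))   ≈⟨ x∙yz≈y∙xz _ _ _ ⟩
    h F.zero * (h′ (F.suc i₀) * product (λ i → h (F.suc i)))   ≈⟨ *-cong (eq F.zero (λ ())) (product-agree-except _ _ i₀ eq′) ⟩
    h′ F.zero * (h (F.suc i₀) * product (λ i → h′ (F.suc i)))  ≈⟨ x∙yz≈y∙xz _ _ _ ⟩
    h (F.suc i₀) * (h′ F.zero * product (λ i → h′ (F.suc i)))  ∎
    where
      eq′ : ∀ i → i ≢ i₀ → h (F.suc i) ≈ h′ (F.suc i)
      eq′ i i≢i₀ = eq (F.suc i) (λ e → i≢i₀ (FP.suc-injective e))

  AdditivePower : ℕ → Set (c ⊔ ℓ)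
  AdditivePower e = ∀ x y → (x + y) ^ e ≈ x ^ e + y ^ e

  additive-1 : AdditivePower 1
  additive-1 x y = trans (*-identityʳ _) (sym (+-cong (*-identityʳ x) (*-identityʳ y)))

  additive-* : ∀ {a b} → AdditivePower a → AdditivePower b → AdditivePower (a ℕ.* b)
  additive-* {a} {b} additive-a additive-b x y = begin
    (x + y) ^ (a ℕ.* b)             ≈⟨ sym (^-assocʳ _ a b) ⟩
    ((x + y) ^ a) ^ b               ≈⟨ ^-congˡ b (additive-a x y) ⟩
    (x ^ a + y ^ a) ^ b             ≈⟨ additive-b _ _ ⟩
    (x ^ a) ^ b + (y ^ a) ^ b       ≈⟨ +-cong (^-assocʳ x a b) (^-assocʳ y a b) ⟩
    x ^ (a ℕ.* b) + y ^ (a ℕ.* b)   ∎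

  additive-^ : ∀ {a} → AdditivePower a → ∀ t → AdditivePower (a ℕ.^ t)
  additive-^ additive-a zero    = additive-1
  additive-^ {a} additive-a (suc t) = additive-* {a} additive-a (additive-^ additive-a t)

  ^-distrib-sum : ∀ {e} → AdditivePower e → 1 ℕ.≤ e → ∀ {n} (f : Fin n → Carrier) →
                  sum f ^ e ≈ sum (λ i → f i ^ e)
  ^-distrib-sum {e} _        1≤e {zero}  f = ^-≈0 e 1≤e refl
  ^-distrib-sum additive-e 1≤e {suc n} f =
    trans (additive-e _ _) (+-congˡ (^-distrib-sum additive-e 1≤e (λ i → f (F.suc i))))

module HomogeneousSum {c ℓ} (K : Field c ℓ) where
  open Field K
  open FieldProperties K
  open import Relation.Binary.Reasoning.Setoid (Field.setoid K)
  open import Algebra.Properties.Semiring.Sum semiring using (*-distribˡ-sum)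
  open import Algebra.Properties.CommutativeSemiring.Exp commutativeSemiring
    using (^-congˡ; ^-congʳ; ^-homo-*)
  open import Algebra.Properties.Ring ring using ([y-z]x≈yx-zx)
  open import Algebra.Solver.Ring.NaturalCoefficients.Default commutativeSemiring
    using (solve; _:=_; _:+_; _:*_; con)

  homSum : Carrier → Carrier → ℕ → Carrier
  homSum α β m = sum {suc m} (λ k → α ^ toℕ k * β ^ (m ℕ.∸ toℕ k))

  homSum-cong : ∀ {α α′ β β′} m → α ≈ α′ → β ≈ β′ → homSum α β m ≈ homSum α′ β′ m
  homSum-cong m α≈α′ β≈β′ = sum-cong {suc m} (λ k → *-cong (^-congˡ (toℕ k) α≈α′) (^-congˡ (m ℕ.∸ toℕ k) β≈β′))

  homSum-suc : ∀ α β m → homSum α β (suc m) ≈ β ^ suc m + α * homSum α β m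
  homSum-suc α β m =
    +-cong (*-identityˡ _)
           (trans (sum-cong {suc m} (λ k → *-assoc α (α ^ toℕ k) (β ^ (m ℕ.∸ toℕ k))))
                  (sym (*-distribˡ-sum {suc m} α (λ k → α ^ toℕ k * β ^ (m ℕ.∸ toℕ k)))))

  -- (α - β) h(α,β) = α^(m+1) - β^(m+1), written without subtraction.
  homSum-telescope : ∀ α β m → α * homSum α β m + β ^ suc m ≈ β * homSum α β m + α ^ suc m
  homSum-telescope α β zero =
    solve 2 (λ α β → (α :* (con 1 :* con 1 :+ con 0) :+ β :* con 1) := (β :* (con 1 :* con 1 :+ con 0) :+ α :* con 1)) refl α β
  homSum-telescope α β (suc m) = begin
    α * homSum α β (suc m) + β * B    ≈⟨ +-congʳ (*-congˡ (homSum-suc α β m)) ⟩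
    α * (B + α * H) + β * B
      ≈⟨ solve 4 (λ α β B H → (α :* (B :+ α :* H) :+ β :* B) := (α :* (α :* H :+ B) :+ β :* B)) refl α β B H ⟩
    α * (α * H + B) + β * B           ≈⟨ +-congʳ (*-congˡ (homSum-telescope α β m)) ⟩
    α * (β * H + A) + β * B
      ≈⟨ solve 5 (λ α β B H A → (α :* (β :* H :+ A) :+ β :* B) := (β :* (B :+ α :* H) :+ α :* A)) refl α β B H A ⟩
    β * (B + α * H) + α * A           ≈⟨ +-congʳ (*-congˡ (sym (homSum-suc α β m))) ⟩
    β * homSum α β (suc m) + α * A    ∎
    where
      A = α ^ suc m
      B = β ^ suc m
      H = homSum α β m

  homSum-≈0 : ∀ α β m → α ^ suc m ≈ β ^ suc m → ¬ α ≈ β → homSum α β m ≈ 0#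
  homSum-≈0 α β m αᵐ⁺¹≈βᵐ⁺¹ α≉β = x*y≈0⇒y≈0 (λ α-β≈0 → α≉β (x-y≈0⇒x≈y α-β≈0)) (begin
    (α - β) * H     ≈⟨ [y-z]x≈yx-zx H α β ⟩
    α * H - β * H   ≈⟨ +-congˡ (-‿cong (sym αH≈βH)) ⟩
    α * H - α * H   ≈⟨ -‿inverseʳ (α * H) ⟩
    0#              ∎)
    where
      H = homSum α β m
      αH≈βH : α * H ≈ β * H
      αH≈βH = +-cancelʳ (trans (homSum-telescope α β m) (+-congˡ αᵐ⁺¹≈βᵐ⁺¹))

  homSum-diag : ∀ α m → homSum α α m ≈ suc m ⊗ α ^ m
  homSum-diag α m = trans (sum-cong {suc m} αᵏαᵐ⁻ᵏ≈αᵐ) (sum-const (suc m) (α ^ m))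
    where
      αᵏαᵐ⁻ᵏ≈αᵐ : ∀ (k : Fin (suc m)) → α ^ toℕ k * α ^ (m ℕ.∸ toℕ k) ≈ α ^ m
      αᵏαᵐ⁻ᵏ≈αᵐ k = trans (sym (^-homo-* α (toℕ k) _)) (^-congʳ α (ℕ.m+[n∸m]≡n (ℕ.≤-pred (FP.toℕ<n k))))

module PolynomialFunctions {c ℓ} (K : Field c ℓ) where
  open Field K
  open FieldProperties K
  open import Relation.Binary.Reasoning.Setoid (Field.setoid K)
  open import Algebra.Solver.Ring.NaturalCoefficients.Default commutativeSemiring
    using (solve; _:=_; _:+_; _:*_)

  -- Poly n f a: f is a polynomial function of degree at most n whose coefficient of xⁿ is a.
  data Poly : ℕ → (Carrier → Carrier) → Carrier → Set (c ⊔ ℓ) where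
    pconst : ∀ a → Poly 0 (λ _ → a) a
    plift  : ∀ {n f a} → Poly n f a → Poly (suc n) f 0#
    padd   : ∀ {n f g a b} → Poly n f a → Poly n g b → Poly n (λ x → f x + g x) (a + b)
    pmulx  : ∀ {n f a} → Poly n f a → Poly (suc n) (λ x → x * f x) a
    pscale : ∀ {n f a} k → Poly n f a → Poly n (λ x → k * f x) (k * a)
    pext   : ∀ {n f g a b} → Poly n f a → (∀ x → f x ≈ g x) → a ≈ b → Poly n g b

  Poly-0-const : ∀ {f a} → Poly 0 f a → ∀ x → f x ≈ a
  Poly-0-const (pconst a)     x = refl
  Poly-0-const (padd p q)     x = +-cong (Poly-0-const p x) (Poly-0-const q x)
  Poly-0-const (pscale k p)   x = *-congˡ (Poly-0-const p x)
  Poly-0-const (pext p f≈g a≈b) x = trans (sym (f≈g x)) (trans (Poly-0-const p x) a≈b)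

  raise : ∀ {m n f a} → m ℕ.< n → Poly m f a → Poly n f 0#
  raise m<n = go (ℕ.≤⇒≤′ m<n)
    where
      go : ∀ {m n f a} → suc m ℕ.≤′ n → Poly m f a → Poly n f 0#
      go ℕ.≤′-refl       p = plift p
      go (ℕ.≤′-step m<n) p = plift (go m<n p)

  zeroPoly : ∀ n → Poly n (λ _ → 0#) 0#
  zeroPoly zero    = pconst 0#
  zeroPoly (suc n) = plift (zeroPoly n)

  monomial : ∀ e → Poly e (λ x → x ^ e) 1#
  monomial zero    = pconst 1#
  monomial (suc e) = pmulx (monomial e)

  Poly-sum : ∀ {n m} (fs : Fin m → Carrier → Carrier) (as : Fin m → Carrier) →
             (∀ i → Poly n (fs i) (as i)) → Poly n (λ x → sum (λ i → fs i x)) (sum as)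
  Poly-sum {n} {zero}  fs as ps = zeroPoly n
  Poly-sum {n} {suc m} fs as ps =
    padd (ps F.zero) (Poly-sum (λ i → fs (F.suc i)) (λ i → as (F.suc i)) (λ i → ps (F.suc i)))

  private
    shift-mul : ∀ t r g a → (t + r) * (t * g + a) ≈ t * ((t + r) * g + a) + r * a
    shift-mul = solve 4 (λ t r g a → ((t :+ r) :* (t :* g :+ a)) := (t :* ((t :+ r) :* g :+ a) :+ r :* a)) refl
    shift-add : ∀ t g₁ a g₂ b → (t * g₁ + a) + (t * g₂ + b) ≈ t * (g₁ + g₂) + (a + b)
    shift-add = solve 5 (λ t g₁ a g₂ b → ((t :* g₁ :+ a) :+ (t :* g₂ :+ b)) := (t :* (g₁ :+ g₂) :+ (a :+ b))) refl
    shift-scale : ∀ k t g a → k * (t * g + a) ≈ t * (k * g) + k * a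
    shift-scale = solve 4 (λ k t g a → (k :* (t :* g :+ a)) := (t :* (k :* g) :+ k :* a)) refl

  remainder-theorem : ∀ {n f a} → Poly (suc n) f a → ∀ r →
                      Σ (Carrier → Carrier) λ g → Poly n g a × (∀ x → f x ≈ (x - r) * g x + f r)
  remainder-theorem {zero} (plift {f = f} p) r =
    (λ _ → 0#) , pconst 0# ,
    λ x → trans (trans (Poly-0-const p x) (sym (Poly-0-const p r))) (sym (trans (+-congʳ (zeroʳ _)) (+-identityˡ _)))
  remainder-theorem {suc n} (plift p) r with remainder-theorem p r
  ... | g , pg , eq = g , plift pg , eq
  remainder-theorem (padd {f = f} {g = h} p q) r with remainder-theorem p r | remainder-theorem q r
  ... | g₁ , p₁ , e₁ | g₂ , p₂ , e₂ =
    (λ x → g₁ x + g₂ x) , padd p₁ p₂ ,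
    λ x → trans (+-cong (e₁ x) (e₂ x)) (shift-add (x - r) (g₁ x) (f r) (g₂ x) (h r))
  remainder-theorem {zero} (pmulx {f = f} {a = a} p) r =
    (λ _ → a) , pconst a , λ x → begin
      x * f x                 ≈⟨ *-congˡ (Poly-0-const p x) ⟩
      x * a                   ≈⟨ *-congʳ (sym (x-y+y≈x x r)) ⟩
      ((x - r) + r) * a       ≈⟨ distribʳ a (x - r) r ⟩
      (x - r) * a + r * a     ≈⟨ +-congˡ (*-congˡ (sym (Poly-0-const p r))) ⟩
      (x - r) * a + r * f r   ∎
  remainder-theorem {suc n} (pmulx {f = f} {a = a} p) r with remainder-theorem p r
  ... | h , ph , eq =
    (λ x → x * h x + f r) , pext (padd (pmulx ph) (raise (ℕ.s≤s ℕ.z≤n) (pconst (f r)))) (λ _ → refl) (+-identityʳ a) ,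
    λ x → begin
      x * f x                                          ≈⟨ *-congˡ (eq x) ⟩
      x * ((x - r) * h x + f r)                        ≈⟨ *-congʳ (sym (x-y+y≈x x r)) ⟩
      ((x - r) + r) * ((x - r) * h x + f r)            ≈⟨ shift-mul (x - r) r (h x) (f r) ⟩
      (x - r) * (((x - r) + r) * h x + f r) + r * f r  ≈⟨ +-congʳ (*-congˡ (+-congʳ (*-congʳ (x-y+y≈x x r)))) ⟩
      (x - r) * (x * h x + f r) + r * f r              ∎
  remainder-theorem (pscale {f = f} k p) r with remainder-theorem p r
  ... | g , pg , eq = (λ x → k * g x) , pscale k pg , λ x → trans (*-congˡ (eq x)) (shift-scale k (x - r) (g x) (f r))
  remainder-theorem (pext p f≈g a≈b) r with remainder-theorem p r
  ... | g , pg , eq = g , pext pg (λ _ → refl) a≈b , λ x → trans (sym (f≈g x)) (trans (eq x) (+-congˡ (f≈g r)))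

  leading≈0-of-roots : ∀ {n f a} → Poly n f a → (xs : Fin (suc n) → Carrier) →
                       (∀ i j → xs i ≈ xs j → i ≡ j) → (∀ i → f (xs i) ≈ 0#) → a ≈ 0#
  leading≈0-of-roots {zero} p xs _ f≈0 = trans (sym (Poly-0-const p (xs F.zero))) (f≈0 F.zero)
  leading≈0-of-roots {suc n} {f} p xs xs-injective f≈0 with remainder-theorem p (xs F.zero)
  ... | g , pg , eq =
    leading≈0-of-roots pg (λ i → xs (F.suc i)) (λ i j e → FP.suc-injective (xs-injective _ _ e)) g≈0
    where
      r = xs F.zero
      g≈0 : ∀ i → g (xs (F.suc i)) ≈ 0#
      g≈0 i = x*y≈0⇒y≈0 s-r≉0 (begin
        (s - r) * g s         ≈⟨ sym (+-identityʳ _) ⟩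
        (s - r) * g s + 0#    ≈⟨ +-congˡ (sym (f≈0 F.zero)) ⟩
        (s - r) * g s + f r   ≈⟨ sym (eq s) ⟩
        f s                   ≈⟨ f≈0 (F.suc i) ⟩
        0#                    ∎)
        where
          s = xs (F.suc i)
          s-r≉0 : ¬ (s - r) ≈ 0#
          s-r≉0 s-r≈0 with xs-injective (F.suc i) F.zero (x-y≈0⇒x≈y s-r≈0)
          ... | ()

module FiniteField {c ℓ} (K : Field c ℓ) (N : ℕ) (enum : Inverse (≡.setoid (Fin N)) (Field.setoid K)) where
  open Field K
  open FieldProperties K
  open PolynomialFunctions K
  open Inverse enum using (to; from; to-cong; from-cong; inverseˡ; inverseʳ)
  open import Relation.Binary.Reasoning.Setoid (Field.setoid K)
  open import Algebra.Properties.Semiring.Sum semiring using (∑-distrib-+; sum-permute)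
  open import Algebra.Properties.CommutativeMonoid.Sum *-commutativeMonoid
    renaming (sum-permute to product-permute) using ()
  open import Algebra.Properties.Semiring.Mult semiring using (×1-homo-*)

  private
    to-from : ∀ x → to (from x) ≈ x
    to-from x = inverseˡ ≡.refl

    from-to : ∀ i → from (to i) ≡ i
    from-to i = inverseʳ refl

    to-injective : ∀ {i j} → to i ≈ to j → i ≡ j
    to-injective {i} {j} e = ≡.trans (≡.sym (from-to i)) (≡.trans (from-cong e) (from-to j))

    from-injective : ∀ {x y} → from x ≡ from y → x ≈ y
    from-injective {x} {y} e = trans (sym (to-from x)) (trans (to-cong e) (to-from y))

    from-≈ : ∀ {i y} → to i ≈ y → from y ≡ i
    from-≈ {i} e = ≡.trans (from-cong (sym e)) (from-to i)

    transport : (f g : Carrier → Carrier) → (∀ {x y} → x ≈ y → f x ≈ f y) → (∀ {x y} → x ≈ y → g x ≈ g y) →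
                (∀ x → f (g x) ≈ x) → (∀ x → g (f x) ≈ x) → Permutation N N
    transport f g f-cong g-cong fg gf = permutation (λ i → from (f (to i))) (λ j → from (g (to j)))
      (λ j → from-≈ (sym (trans (f-cong (to-from _)) (fg (to j)))))
      (λ i → from-≈ (sym (trans (g-cong (to-from _)) (gf (to i)))))

  infix 4 _≟_
  _≟_ : Decidable _≈_
  x ≟ y with from x FP.≟ from y
  ... | yes e = yes (from-injective e)
  ... | no ne = no (λ e → ne (from-cong e))

  ∃-nonroot : ∀ {n f a} → Poly n f a → ¬ a ≈ 0# → n ℕ.< N → Σ Carrier λ x → ¬ f x ≈ 0#
  ∃-nonroot {n} {f} p a≉0 n<N with FP.¬∀⟶∃¬ N (λ i → f (to i) ≈ 0#) (λ i → f (to i) ≟ 0#) not-all-roots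
    where
      xs : Fin (suc n) → Carrier
      xs j = to (F.inject≤ j n<N)
      not-all-roots : ¬ (∀ i → f (to i) ≈ 0#)
      not-all-roots all = a≉0 (leading≈0-of-roots p xs
        (λ i j e → FP.inject≤-injective n<N n<N i j (to-injective e)) (λ j → all _))
  ... | i , fi≉0 = to i , fi≉0

  -- Translation permutes K, so Σ x = Σ (a + x) = N a + Σ x.
  N×x≈0 : ∀ a → N ⊗ a ≈ 0#
  N×x≈0 a = +-cancelʳ (begin
    N ⊗ a + sum to                       ≈⟨ +-congʳ (sym (sum-const N a)) ⟩
    sum (λ (_ : Fin N) → a) + sum to     ≈⟨ sym (∑-distrib-+ (λ _ → a) to) ⟩
    sum (λ i → a + to i)                 ≈⟨ sum-cong {N} (λ i → sym (to-from (a + to i))) ⟩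
    sum (λ i → to (from (a + to i)))     ≈⟨ sym (sum-permute to translation) ⟩
    sum to                               ≈⟨ sym (+-identityˡ _) ⟩
    0# + sum to                          ∎)
    where
      translation : Permutation N N
      translation = transport (a +_) (- a +_) +-congˡ +-congˡ
        (λ y → trans (sym (+-assoc _ _ _)) (trans (+-congʳ (-‿inverseʳ a)) (+-identityˡ y)))
        (λ y → trans (sym (+-assoc _ _ _)) (trans (+-congʳ (-‿inverseˡ a)) (+-identityˡ y)))

  private
    zeroTo1 : Carrier → Carrier
    zeroTo1 y with y ≟ 0#
    ... | yes _ = 1#
    ... | no  _ = y

    zeroTo1-≉0 : ∀ y → ¬ zeroTo1 y ≈ 0#
    zeroTo1-≉0 y with y ≟ 0#
    ... | yes _   = 1≉0
    ... | no y≉0  = y≉0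

    zeroTo1-≈0 : ∀ {y} → y ≈ 0# → zeroTo1 y ≈ 1#
    zeroTo1-≈0 {y} y≈0 with y ≟ 0#
    ... | yes _   = refl
    ... | no y≉0  = ⊥-elim (y≉0 y≈0)

    zeroTo1-≉ : ∀ {y} → ¬ y ≈ 0# → zeroTo1 y ≈ y
    zeroTo1-≉ {y} y≉0 with y ≟ 0#
    ... | yes y≈0 = ⊥-elim (y≉0 y≈0)
    ... | no  _   = refl

    zeroTo1-cong : ∀ {y y′} → y ≈ y′ → zeroTo1 y ≈ zeroTo1 y′
    zeroTo1-cong {y} {y′} y≈y′ with y ≟ 0#
    ... | yes y≈0 = sym (zeroTo1-≈0 (trans (sym y≈y′) y≈0))
    ... | no  y≉0 = sym (trans (zeroTo1-≉ (λ y′≈0 → y≉0 (trans y≈y′ y′≈0))) (sym y≈y′))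

  1≤N : 1 ℕ.≤ N
  1≤N = ℕ.≤-trans (ℕ.s≤s ℕ.z≤n) (FP.toℕ<n (from 0#))

  -- With P the product of all elements with 0 replaced by 1, multiplying by a ≉ 0
  -- permutes the factors: a P ≈ aᴺ P, the factor at 0 contributing a on the left only.
  x^N≈x : ∀ a → a ^ N ≈ a
  x^N≈x a with a ≟ 0#
  ... | yes a≈0 = trans (^-≈0 N 1≤N a≈0) (sym a≈0)
  ... | no  a≉0 = sym (*-cancelʳ (product-≉0 g (λ i → zeroTo1-≉0 (to i))) (begin
    a * product g          ≈⟨ *-cong (sym (trans (*-congˡ (zeroTo1-≈0 to-i₀≈0)) (*-identityʳ a))) g≈h ⟩
    h′ i₀ * product h      ≈⟨ product-agree-except h h′ i₀ h≈h′ ⟩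
    h i₀ * product h′      ≈⟨ *-congʳ (zeroTo1-≈0 (trans (*-congˡ to-i₀≈0) (zeroʳ a))) ⟩
    1# * product h′        ≈⟨ *-identityˡ _ ⟩
    product h′             ≈⟨ product-scale a g ⟩
    a ^ N * product g      ∎))
    where
      g h h′ : Fin N → Carrier
      g i  = zeroTo1 (to i)
      h i  = zeroTo1 (a * to i)
      h′ i = a * g i
      i₀ = from 0#
      to-i₀≈0 : to i₀ ≈ 0#
      to-i₀≈0 = to-from 0#
      dilation : Permutation N N
      dilation = transport (a *_) (a ⁻¹ *_) *-congˡ *-congˡ
        (λ y → trans (sym (*-assoc _ _ _)) (trans (*-congʳ (⁻¹-inverse a a≉0)) (*-identityˡ y)))
        (λ y → trans (sym (*-assoc _ _ _)) (trans (*-congʳ (⁻¹-inverseˡ a a≉0)) (*-identityˡ y)))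
      g≈h : product g ≈ product h
      g≈h = trans (product-permute g dilation) (product-cong {N} (λ i → zeroTo1-cong (to-from _)))
      h≈h′ : ∀ i → i ≢ i₀ → h i ≈ h′ i
      h≈h′ i i≢i₀ = trans (zeroTo1-≉ (*-≉0 a≉0 to-i≉0)) (*-congˡ (sym (zeroTo1-≉ to-i≉0)))
        where
          to-i≉0 : ¬ to i ≈ 0#
          to-i≉0 to-i≈0 = i≢i₀ (≡.sym (from-≈ to-i≈0))

  injective⇒surjective : ∀ (f : Carrier → Carrier) → (∀ {x y} → x ≈ y → f x ≈ f y) →
                         (∀ {x y} → f x ≈ f y → x ≈ y) → Surjective _≈_ _≈_ f
  injective⇒surjective f f-cong f-injective y
    with Fin-injective⇒surjective (λ i → from (f (to i))) (λ e → to-injective (f-injective (from-injective e))) (from y)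
  ... | i , e = to i , λ {w} w≈to-i → trans (f-cong w≈to-i) (from-injective e)

  order≡p^t⇒p×1≈0 : ∀ p t → N ≡ p ℕ.^ t → p ⊗ 1# ≈ 0#
  order≡p^t⇒p×1≈0 p t N≡pᵗ with p ⊗ 1# ≟ 0#
  ... | yes p≈0 = p≈0
  ... | no  p≉0 = ⊥-elim (pᵗ≉0 t (≡.subst (λ n → n ⊗ 1# ≈ 0#) N≡pᵗ (N×x≈0 1#)))
    where
      pᵗ≉0 : ∀ t → ¬ (p ℕ.^ t) ⊗ 1# ≈ 0#
      pᵗ≉0 zero    = 1≉0 ∘ trans (sym (+-identityʳ 1#))
      pᵗ≉0 (suc t) = *-≉0 p≉0 (pᵗ≉0 t) ∘ trans (sym (×1-homo-* p (p ℕ.^ t)))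

module PrimeCharacteristic {c ℓ} (K : Field c ℓ) where
  open Field K
  open FieldProperties K
  open import Relation.Binary.Reasoning.Setoid (Field.setoid K)
  open import Algebra.Properties.Semiring.Mult semiring using (×-assocˡ; ×-congʳ; ×-homo-1)
  import Algebra.Properties.CommutativeSemiring.Binomial commutativeSemiring as Binomial

  char∣n⇒n×x≈0 : ∀ {r} → r ⊗ 1# ≈ 0# → ∀ n x → r ∣ n → n ⊗ x ≈ 0#
  char∣n⇒n×x≈0 {r} r×1≈0 n x (divides t ≡.refl) = begin
    (t ℕ.* r) ⊗ x   ≈⟨ sym (×-assocˡ x t r) ⟩
    t ⊗ (r ⊗ x)     ≈⟨ ×-congʳ t (trans (×≈×1* r x) (trans (*-congʳ r×1≈0) (zeroˡ x))) ⟩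
    t ⊗ 0#          ≈⟨ t×0≈0 t ⟩
    0#              ∎
    where
      t×0≈0 : ∀ t → t ⊗ 0# ≈ 0#
      t×0≈0 zero    = refl
      t×0≈0 (suc t) = trans (+-congˡ (t×0≈0 t)) (+-identityˡ 0#)

  -- In (x + y)ᵖ only the two extreme binomial terms survive, since p ∣ p C k for 0 < k < p.
  frobenius : ∀ {p} → Prime p → p ⊗ 1# ≈ 0# → AdditivePower p
  frobenius {suc (suc p′)} p-prime p×1≈0 x y = begin
    (x + y) ^ p                          ≈⟨ Binomial.theorem p x y ⟩
    Binomial.binomialExpansion x y p     ≈⟨ +-cong first (trans (sum-single _ last middle≈0) final) ⟩
    y ^ p + x ^ p                        ≈⟨ +-comm _ _ ⟩
    x ^ p + y ^ p                        ∎
    where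
      p = suc (suc p′)
      term = Binomial.binomialTerm x y p
      last = F.fromℕ (suc p′)
      first : term F.zero ≈ y ^ p
      first = begin
        (p C 0) ⊗ (1# * y ^ p)   ≡⟨ ≡.cong (_⊗ (1# * y ^ p)) (≡.trans (nCk≡nC[n∸k] {0} {p} ℕ.z≤n) (nCn≡1 p)) ⟩
        1 ⊗ (1# * y ^ p)         ≈⟨ ×-homo-1 _ ⟩
        1# * y ^ p               ≈⟨ *-identityˡ _ ⟩
        y ^ p                    ∎
      final : term (F.suc last) ≈ x ^ p
      final = begin
        (p C toℕ (F.suc last)) ⊗ (x ^ toℕ (F.suc last) * y ^ (p ℕ.∸ toℕ (F.suc last)))
          ≡⟨ ≡.cong (λ k → (p C k) ⊗ (x ^ k * y ^ (p ℕ.∸ k))) (≡.cong suc (FP.toℕ-fromℕ (suc p′))) ⟩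
        (p C p) ⊗ (x ^ p * y ^ (p ℕ.∸ p))
          ≡⟨ ≡.cong₂ (λ k e → k ⊗ (x ^ p * y ^ e)) (nCn≡1 p) (ℕ.n∸n≡0 p) ⟩
        1 ⊗ (x ^ p * 1#)         ≈⟨ ×-homo-1 _ ⟩
        x ^ p * 1#               ≈⟨ *-identityʳ _ ⟩
        x ^ p                    ∎
      middle≈0 : ∀ i → i ≢ last → term (F.suc i) ≈ 0#
      middle≈0 i i≢last = char∣n⇒n×x≈0 p×1≈0 _ _ (prime∣pCk p-prime (ℕ.s≤s ℕ.z≤n) 1+i<p)
        where
          1+i<p : suc (toℕ i) ℕ.< p
          1+i<p = ℕ.s≤s (ℕ.≤∧≢⇒< (ℕ.≤-pred (FP.toℕ<n i))
                    (λ e → i≢last (FP.toℕ-injective (≡.trans e (≡.sym (FP.toℕ-fromℕ (suc p′)))))))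

module RootsOfUnity {c ℓ} (K : Field c ℓ) (n : ℕ) {ω : Field.Carrier K} (ω-primitive : PrimitiveRoot K (suc n) ω) where
  open Field K
  open FieldProperties K
  open HomogeneousSum K
  open import Relation.Binary.Reasoning.Setoid (Field.setoid K)
  open import Algebra.Properties.CommutativeSemiring.Exp commutativeSemiring
    using (^-congˡ; ^-congʳ; ^-homo-*; ^-assocʳ; ^-distrib-*)

  d : ℕ
  d = suc n

  ωᵈ≈1 : ω ^ d ≈ 1#
  ωᵈ≈1 = proj₁ ω-primitive

  ω≉0 : ¬ ω ≈ 0#
  ω≉0 ω≈0 = 1≉0 (trans (sym ωᵈ≈1) (^-≈0 d (ℕ.s≤s ℕ.z≤n) ω≈0))

  [ωᵃ]ᵈ≈1 : ∀ a → (ω ^ a) ^ d ≈ 1#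
  [ωᵃ]ᵈ≈1 a = trans (^-comm ω a d) (trans (^-congˡ a ωᵈ≈1) (1^n≈1 a))

  ωᵃ≈ω^[a%d] : ∀ a → ω ^ a ≈ ω ^ (a % d)
  ωᵃ≈ω^[a%d] a = begin
    ω ^ a                                   ≡⟨ ≡.cong (ω ^_) (m≡m%n+[m/n]*n a d) ⟩
    ω ^ (a % d ℕ.+ (a / d) ℕ.* d)           ≈⟨ ^-homo-* ω (a % d) _ ⟩
    ω ^ (a % d) * ω ^ ((a / d) ℕ.* d)       ≈⟨ *-congˡ (trans (^-* ω (a / d) d) (trans (^-congˡ (a / d) ωᵈ≈1) (1^n≈1 (a / d)))) ⟩
    ω ^ (a % d) * 1#                        ≈⟨ *-identityʳ _ ⟩
    ω ^ (a % d)                             ∎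

  private
    ω^-injective-< : ∀ {a b} → a ℕ.< b → b ℕ.< d → ¬ ω ^ a ≈ ω ^ b
    ω^-injective-< {a} {b} a<b b<d ωᵃ≈ωᵇ =
      proj₂ ω-primitive (b ℕ.∸ a) (ℕ.m<n⇒0<n∸m a<b) (ℕ.≤-<-trans (ℕ.m∸n≤m b a) b<d)
        (*-cancelˡ (^-≉0 a ω≉0) (begin
          ω ^ a * ω ^ (b ℕ.∸ a)   ≈⟨ sym (^-homo-* ω a (b ℕ.∸ a)) ⟩
          ω ^ (a ℕ.+ (b ℕ.∸ a))   ≡⟨ ≡.cong (ω ^_) (ℕ.m+[n∸m]≡n (ℕ.<⇒≤ a<b)) ⟩
          ω ^ b                   ≈⟨ sym ωᵃ≈ωᵇ ⟩
          ω ^ a                   ≈⟨ sym (*-identityʳ _) ⟩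
          ω ^ a * 1#              ∎))

  ω^-injective : ∀ {a b} → a ℕ.< d → b ℕ.< d → ω ^ a ≈ ω ^ b → a ≡ b
  ω^-injective {a} {b} a<d b<d ωᵃ≈ωᵇ with ℕ.<-cmp a b
  ... | tri< a<b _ _ = ⊥-elim (ω^-injective-< a<b b<d ωᵃ≈ωᵇ)
  ... | tri≈ _ a≡b _ = a≡b
  ... | tri> _ _ b<a = ⊥-elim (ω^-injective-< b<a a<d (sym ωᵃ≈ωᵇ))

  homSum-ω-≈ : ∀ j s → ω ^ j ≈ ω ^ s → homSum (ω ^ j) (ω ^ s) n ≈ d ⊗ (ω ^ j) ^ n
  homSum-ω-≈ j s ωʲ≈ωˢ = trans (homSum-cong n refl (sym ωʲ≈ωˢ)) (homSum-diag (ω ^ j) n)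

  homSum-ω-≉ : ∀ j s → ¬ ω ^ j ≈ ω ^ s → homSum (ω ^ j) (ω ^ s) n ≈ 0#
  homSum-ω-≉ j s = homSum-≈0 (ω ^ j) (ω ^ s) n (trans ([ωᵃ]ᵈ≈1 j) (sym ([ωᵃ]ᵈ≈1 s)))

  powerSum : Carrier → Carrier
  powerSum β = sum {d} (λ i → β ^ toℕ i)

  powerSum-1 : powerSum 1# ≈ d ⊗ 1#
  powerSum-1 = trans (sum-cong {d} (λ i → 1^n≈1 (toℕ i))) (sum-const d 1#)

  powerSum-ωˢ : ∀ s → 0 ℕ.< s → s ℕ.< d → powerSum (ω ^ s) ≈ 0#
  powerSum-ωˢ s 0<s s<d =
    trans (sum-cong {d} {g = λ i → (ω ^ s) ^ toℕ i * 1# ^ (n ℕ.∸ toℕ i)}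
                     (λ i → sym (trans (*-congˡ (1^n≈1 (n ℕ.∸ toℕ i))) (*-identityʳ _))))
          (homSum-≈0 (ω ^ s) 1# n (trans ([ωᵃ]ᵈ≈1 s) (sym (1^n≈1 d))) ωˢ≉1)
    where
      ωˢ≉1 : ¬ ω ^ s ≈ 1#
      ωˢ≉1 ωˢ≈1 with ω^-injective {s} {0} s<d (ℕ.s≤s ℕ.z≤n) ωˢ≈1
      ωˢ≉1 ωˢ≈1 | ≡.refl = ℕ.<-irrefl ≡.refl 0<s

  [ωʲ]ⁿ≈[ω⁻¹]ʲ : ∀ j → (ω ^ j) ^ n ≈ (ω ⁻¹) ^ j
  [ωʲ]ⁿ≈[ω⁻¹]ʲ j = *-cancelˡ (^-≉0 j ω≉0) (begin
    ω ^ j * (ω ^ j) ^ n        ≈⟨ [ωᵃ]ᵈ≈1 j ⟩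
    1#                         ≈⟨ sym (1^n≈1 j) ⟩
    1# ^ j                     ≈⟨ ^-congˡ j (sym (⁻¹-inverse ω ω≉0)) ⟩
    (ω * ω ⁻¹) ^ j             ≈⟨ ^-distrib-* ω (ω ⁻¹) j ⟩
    ω ^ j * (ω ⁻¹) ^ j         ∎)

module FrobeniusEigenspaces {c ℓ} (K : Field c ℓ) {p k : ℕ} (p-prime : Prime p) (1≤k : 1 ℕ.≤ k)
  {q : ℕ} (q≡pᵏ : q ≡ p ℕ.^ k) (n : ℕ) (enum : Inverse (≡.setoid (Fin (q ℕ.^ suc n))) (Field.setoid K))
  {ω : Field.Carrier K} (ω∈Fq : InSubfield K q ω) (ω-primitive : PrimitiveRoot K (suc n) ω) where
  open Field K
  open FieldProperties K
  open HomogeneousSum K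
  open PolynomialFunctions K
  open FiniteField K (q ℕ.^ suc n) enum
  open RootsOfUnity K n ω-primitive
  open PrimeCharacteristic K
  open import Relation.Binary.Reasoning.Setoid (Field.setoid K)
  open import Algebra.Properties.Semiring.Sum semiring using (*-distribˡ-sum; *-distribʳ-sum; ∑-comm; sum-init-last)
  open import Algebra.Properties.Semiring.Mult semiring using (×-homo-+; ×1-homo-*)
  open import Algebra.Properties.CommutativeSemiring.Exp commutativeSemiring
    using (^-congˡ; ^-congʳ; ^-homo-*; ^-assocʳ; ^-distrib-*)
  open import Algebra.Properties.CommutativeSemigroup *-commutativeSemigroup using (interchange; x∙yz≈y∙xz)
  open import Algebra.Properties.Ring ring using (-1*x≈-x)

  N : ℕ
  N = q ℕ.^ d

  2≤q : 2 ℕ.≤ q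
  2≤q = ≡.subst (2 ℕ.≤_) (≡.sym q≡pᵏ) (ℕ.≤-trans (1<prime p-prime) (m≤m^n 1≤k (ℕ.<⇒≤ (1<prime p-prime))))

  q-1 : ℕ
  q-1 = q ℕ.∸ 1

  q≡1+[q-1] : q ≡ suc q-1
  q≡1+[q-1] = ≡.sym (ℕ.suc-pred q {{ℕ.>-nonZero (ℕ.<⇒≤ 2≤q)}})

  1≤qᵗ : ∀ t → 1 ℕ.≤ q ℕ.^ t
  1≤qᵗ t = ℕ.m^n>0 q {{ℕ.>-nonZero (ℕ.<⇒≤ 2≤q)}} t

  p×1≈0 : p ⊗ 1# ≈ 0#
  p×1≈0 = order≡p^t⇒p×1≈0 p (k ℕ.* d) (≡.trans (≡.cong (ℕ._^ d) q≡pᵏ) (ℕ.^-*-assoc p k d))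

  additive-q : AdditivePower q
  additive-q = ≡.subst AdditivePower (≡.sym q≡pᵏ) (additive-^ (frobenius p-prime p×1≈0) k)

  ^q-distrib-sum : ∀ {m} (f : Fin m → Carrier) → sum f ^ q ≈ sum (λ i → f i ^ q)
  ^q-distrib-sum = ^-distrib-sum additive-q (ℕ.<⇒≤ 2≤q)

  ^qᵗ-distrib-sum : ∀ t {m} (f : Fin m → Carrier) → sum f ^ (q ℕ.^ t) ≈ sum (λ i → f i ^ (q ℕ.^ t))
  ^qᵗ-distrib-sum t = ^-distrib-sum (additive-^ additive-q t) (1≤qᵗ t)

  d×1≉0 : q % d ≡ 1 → ¬ d ⊗ 1# ≈ 0#
  d×1≉0 q%d≡1 d×1≈0 = 1≉0 (sym (begin
    0#                                 ≈⟨ sym (char∣n⇒n×x≈0 p×1≈0 q 1# p∣q) ⟩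
    q ⊗ 1#                             ≡⟨ ≡.cong (_⊗ 1#) (≡.trans (m≡m%n+[m/n]*n q d) (≡.cong (ℕ._+ (q / d) ℕ.* d) q%d≡1)) ⟩
    (1 ℕ.+ (q / d) ℕ.* d) ⊗ 1#         ≈⟨ ×-homo-+ 1# 1 ((q / d) ℕ.* d) ⟩
    1 ⊗ 1# + ((q / d) ℕ.* d) ⊗ 1#      ≈⟨ +-cong (+-identityʳ 1#) (×1-homo-* (q / d) d) ⟩
    1# + ((q / d) ⊗ 1#) * (d ⊗ 1#)     ≈⟨ +-congˡ (trans (*-congˡ d×1≈0) (zeroʳ _)) ⟩
    1# + 0#                            ≈⟨ +-identityʳ 1# ⟩
    1#                                 ∎))
    where
      p∣q : p ∣ q
      p∣q = ≡.subst (p ∣_) (≡.sym q≡pᵏ) (m∣m^n 1≤k)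

  ^qᵗ-fixes-Fq : ∀ {a} → a ^ q ≈ a → ∀ t → a ^ (q ℕ.^ t) ≈ a
  ^qᵗ-fixes-Fq {a} a^q≈a zero    = *-identityʳ a
  ^qᵗ-fixes-Fq {a} a^q≈a (suc t) = begin
    a ^ (q ℕ.* q ℕ.^ t)    ≈⟨ sym (^-assocʳ a q (q ℕ.^ t)) ⟩
    (a ^ q) ^ (q ℕ.^ t)    ≈⟨ ^-congˡ (q ℕ.^ t) a^q≈a ⟩
    a ^ (q ℕ.^ t)          ≈⟨ ^qᵗ-fixes-Fq a^q≈a t ⟩
    a                      ∎

  ωˢ∈Fq : ∀ s → (ω ^ s) ^ q ≈ ω ^ s
  ωˢ∈Fq s = trans (^-comm ω s q) (^-congˡ s ω∈Fq)

  Eigen : ℕ → Carrier → Set ℓ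
  Eigen s y = y ^ q ≈ ω ^ s * y

  Eigen-^qᵗ : ∀ {s y} → Eigen s y → ∀ t → y ^ (q ℕ.^ t) ≈ (ω ^ s) ^ t * y
  Eigen-^qᵗ {s} {y} eigen zero    = trans (*-identityʳ y) (sym (*-identityˡ y))
  Eigen-^qᵗ {s} {y} eigen (suc t) = begin
    y ^ (q ℕ.* q ℕ.^ t)                    ≈⟨ sym (^-assocʳ y q (q ℕ.^ t)) ⟩
    (y ^ q) ^ (q ℕ.^ t)                    ≈⟨ ^-congˡ (q ℕ.^ t) eigen ⟩
    (ω ^ s * y) ^ (q ℕ.^ t)                ≈⟨ ^-distrib-* (ω ^ s) y (q ℕ.^ t) ⟩
    (ω ^ s) ^ (q ℕ.^ t) * y ^ (q ℕ.^ t)    ≈⟨ *-cong (^qᵗ-fixes-Fq (ωˢ∈Fq s) t) (Eigen-^qᵗ {s} eigen t) ⟩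
    ω ^ s * ((ω ^ s) ^ t * y)              ≈⟨ sym (*-assoc _ _ _) ⟩
    (ω ^ s) ^ suc t * y                    ∎

  Eigen-scale : ∀ {s y a} → a ^ q ≈ a → Eigen s y → Eigen s (a * y)
  Eigen-scale {s} {y} {a} a^q≈a eigen = begin
    (a * y) ^ q       ≈⟨ ^-distrib-* a y q ⟩
    a ^ q * y ^ q     ≈⟨ *-cong a^q≈a eigen ⟩
    a * (ω ^ s * y)   ≈⟨ x∙yz≈y∙xz a (ω ^ s) y ⟩
    ω ^ s * (a * y)   ∎

  Eigen-^ : ∀ {s y} → Eigen s y → ∀ m → Eigen (s ℕ.* m) (y ^ m)
  Eigen-^ {s} {y} eigen m = begin
    (y ^ m) ^ q            ≈⟨ ^-comm y m q ⟩
    (y ^ q) ^ m            ≈⟨ ^-congˡ m eigen ⟩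
    (ω ^ s * y) ^ m        ≈⟨ ^-distrib-* (ω ^ s) y m ⟩
    (ω ^ s) ^ m * y ^ m    ≈⟨ *-congʳ (^-assocʳ ω s m) ⟩
    ω ^ (s ℕ.* m) * y ^ m  ∎

  Eigen-^[q-1] : ∀ {s y} → Eigen s y → ¬ y ≈ 0# → y ^ q-1 ≈ ω ^ s
  Eigen-^[q-1] {s} {y} eigen y≉0 = *-cancelˡ y≉0 (begin
    y * y ^ q-1    ≡⟨ ≡.cong (y ^_) (≡.sym q≡1+[q-1]) ⟩
    y ^ q          ≈⟨ eigen ⟩
    ω ^ s * y      ≈⟨ *-comm _ _ ⟩
    y * ω ^ s      ∎)

  A : ℕ → Carrier → Carrier
  A j x = Apoly K q d ω j x

  A-cong : ∀ j {x y} → x ≈ y → A j x ≈ A j y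
  A-cong j {y = y} x≈y = sum-cong {d} {g = λ k → ω ^ (j ℕ.* toℕ k) * y ^ (q ℕ.^ (n ℕ.∸ toℕ k))}
                          (λ k → *-congˡ (^-congˡ (q ℕ.^ (n ℕ.∸ toℕ k)) x≈y))

  A-on-Eigen : ∀ j s {y} → Eigen s y → A j y ≈ homSum (ω ^ j) (ω ^ s) n * y
  A-on-Eigen j s {y} eigen = begin
    sum {d} (λ k → ω ^ (j ℕ.* toℕ k) * y ^ (q ℕ.^ (n ℕ.∸ toℕ k)))
      ≈⟨ sum-cong {d} {g = λ k → ((ω ^ j) ^ toℕ k * (ω ^ s) ^ (n ℕ.∸ toℕ k)) * y}
           (λ k → trans (*-cong (sym (^-assocʳ ω j (toℕ k))) (Eigen-^qᵗ {s} eigen (n ℕ.∸ toℕ k))) (sym (*-assoc _ _ _))) ⟩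
    sum {d} (λ k → ((ω ^ j) ^ toℕ k * (ω ^ s) ^ (n ℕ.∸ toℕ k)) * y)
      ≈⟨ sym (*-distribʳ-sum {d} y (λ k → (ω ^ j) ^ toℕ k * (ω ^ s) ^ (n ℕ.∸ toℕ k))) ⟩
    homSum (ω ^ j) (ω ^ s) n * y
      ∎

  A-sum : ∀ j {m} (f : Fin m → Carrier) → A j (sum f) ≈ sum (λ i → A j (f i))
  A-sum j {m} f = begin
    sum {d} (λ k → ω ^ (j ℕ.* toℕ k) * sum f ^ (q ℕ.^ (n ℕ.∸ toℕ k)))
      ≈⟨ sum-cong {d} {g = λ k → sum {m} (λ i → ω ^ (j ℕ.* toℕ k) * f i ^ (q ℕ.^ (n ℕ.∸ toℕ k)))}
           (λ k → trans (*-congˡ (^qᵗ-distrib-sum (n ℕ.∸ toℕ k) f))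
                        (*-distribˡ-sum (ω ^ (j ℕ.* toℕ k)) (λ i → f i ^ (q ℕ.^ (n ℕ.∸ toℕ k))))) ⟩
    sum {d} (λ k → sum {m} (λ i → ω ^ (j ℕ.* toℕ k) * f i ^ (q ℕ.^ (n ℕ.∸ toℕ k))))
      ≈⟨ ∑-comm {d} {m} (λ k i → ω ^ (j ℕ.* toℕ k) * f i ^ (q ℕ.^ (n ℕ.∸ toℕ k))) ⟩
    sum {m} (λ i → A j (f i))
      ∎

  A-0 : ∀ j → A j 0# ≈ 0#
  A-0 j = sum-≈0 {d} (λ k → ω ^ (j ℕ.* toℕ k) * 0# ^ (q ℕ.^ (n ℕ.∸ toℕ k)))
    (λ k → trans (*-congˡ (^-≈0 (q ℕ.^ (n ℕ.∸ toℕ k)) (1≤qᵗ (n ℕ.∸ toℕ k)) refl)) (zeroʳ _))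

  -- Raising to the q-th power shifts the exponents q^(n-k) cyclically, using x^(q^d) = x.
  A-Eigen : ∀ i x → Eigen i (A i x)
  A-Eigen i x = begin
    A i x ^ q
      ≈⟨ ^q-distrib-sum {d} (λ k → ω ^ (i ℕ.* toℕ k) * x ^ (q ℕ.^ (n ℕ.∸ toℕ k))) ⟩
    sum {d} (λ k → (ω ^ (i ℕ.* toℕ k) * x ^ (q ℕ.^ (n ℕ.∸ toℕ k))) ^ q)
      ≈⟨ sum-cong {d} {g = λ k → ω ^ (i ℕ.* toℕ k) * T (suc (n ℕ.∸ toℕ k))}
           (λ k → trans (^-distrib-* _ _ q) (*-cong (ωˢ∈Fq (i ℕ.* toℕ k)) (T-step (n ℕ.∸ toℕ k)))) ⟩
    sum {d} (λ k → ω ^ (i ℕ.* toℕ k) * T (suc (n ℕ.∸ toℕ k)))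
      ≈⟨ +-cong wrap shift ⟩
    Y + sum {n} (λ k → ω ^ i * term (F.inject₁ k))
      ≈⟨ +-comm _ _ ⟩
    sum {n} (λ k → ω ^ i * term (F.inject₁ k)) + Y
      ≈⟨ sym (sum-init-last {n} (λ k → ω ^ i * term k)) ⟩
    sum {d} (λ k → ω ^ i * term k)
      ≈⟨ sym (*-distribˡ-sum {d} (ω ^ i) term) ⟩
    ω ^ i * A i x
      ∎
    where
      T : ℕ → Carrier
      T t = x ^ (q ℕ.^ t)
      T-step : ∀ t → T t ^ q ≈ T (suc t)
      T-step t = trans (^-assocʳ x (q ℕ.^ t) q) (^-congʳ x (ℕ.*-comm (q ℕ.^ t) q))
      term : Fin d → Carrier
      term k = ω ^ (i ℕ.* toℕ k) * T (n ℕ.∸ toℕ k)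
      Y = ω ^ i * term (F.fromℕ n)
      wrap : ω ^ (i ℕ.* 0) * T (suc n) ≈ Y
      wrap = begin
        ω ^ (i ℕ.* 0) * T (suc n)         ≈⟨ *-cong (^-congʳ ω (ℕ.*-zeroʳ i)) (x^N≈x x) ⟩
        1# * x                            ≈⟨ *-congʳ (sym (trans (sym (^-assocʳ ω i d)) ([ωᵃ]ᵈ≈1 i))) ⟩
        ω ^ (i ℕ.* d) * x                 ≡⟨ ≡.cong (λ e → ω ^ e * x) (ℕ.*-suc i n) ⟩
        ω ^ (i ℕ.+ i ℕ.* n) * x           ≈⟨ *-cong (^-homo-* ω i (i ℕ.* n)) (sym (*-identityʳ x)) ⟩
        (ω ^ i * ω ^ (i ℕ.* n)) * T 0     ≈⟨ *-assoc _ _ _ ⟩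
        ω ^ i * (ω ^ (i ℕ.* n) * T 0)     ≡⟨ ≡.cong (λ e → ω ^ i * (ω ^ (i ℕ.* n) * T e)) (≡.sym (ℕ.n∸n≡0 n)) ⟩
        ω ^ i * (ω ^ (i ℕ.* n) * T (n ℕ.∸ n))
                                          ≡⟨ ≡.cong (λ e → ω ^ i * (ω ^ (i ℕ.* e) * T (n ℕ.∸ e))) (≡.sym (FP.toℕ-fromℕ n)) ⟩
        Y                                 ∎
      shift : sum {n} (λ k → ω ^ (i ℕ.* suc (toℕ k)) * T (suc (n ℕ.∸ suc (toℕ k))))
              ≈ sum {n} (λ k → ω ^ i * term (F.inject₁ k))
      shift = sum-cong {n} step
        where
          step : ∀ (k : Fin n) → ω ^ (i ℕ.* suc (toℕ k)) * T (suc (n ℕ.∸ suc (toℕ k))) ≈ ω ^ i * term (F.inject₁ k)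
          step k rewrite FP.toℕ-inject₁ k = begin
            ω ^ (i ℕ.* suc (toℕ k)) * T (suc (n ℕ.∸ suc (toℕ k)))
              ≡⟨ ≡.cong₂ (λ a b → ω ^ a * T b) (ℕ.*-suc i (toℕ k)) (≡.sym (ℕ.+-∸-assoc 1 (FP.toℕ<n k))) ⟩
            ω ^ (i ℕ.+ i ℕ.* toℕ k) * T (n ℕ.∸ toℕ k)
              ≈⟨ *-congʳ (^-homo-* ω i _) ⟩
            (ω ^ i * ω ^ (i ℕ.* toℕ k)) * T (n ℕ.∸ toℕ k)
              ≈⟨ *-assoc _ _ _ ⟩
            ω ^ i * (ω ^ (i ℕ.* toℕ k) * T (n ℕ.∸ toℕ k))
              ∎

  -- Σᵢ ωⁱ Aᵢ(x) = Σₖ (Σᵢ ω^((k+1)i)) x^(q^(n-k)); the inner power sum vanishes unless k = n.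
  ∑ωⁱAᵢ≈d*x : ∀ x → sum {d} (λ i → ω ^ toℕ i * A (toℕ i) x) ≈ (d ⊗ 1#) * x
  ∑ωⁱAᵢ≈d*x x = begin
    sum {d} (λ i → ω ^ toℕ i * A (toℕ i) x)
      ≈⟨ sum-cong {d} {g = λ i → sum {d} (λ k → (ω ^ suc (toℕ k)) ^ toℕ i * T k)} expand ⟩
    sum {d} (λ i → sum {d} (λ k → (ω ^ suc (toℕ k)) ^ toℕ i * T k))
      ≈⟨ ∑-comm {d} {d} (λ i k → (ω ^ suc (toℕ k)) ^ toℕ i * T k) ⟩
    sum {d} (λ k → sum {d} (λ i → (ω ^ suc (toℕ k)) ^ toℕ i * T k))
      ≈⟨ sum-cong {d} {g = λ k → powerSum (ω ^ suc (toℕ k)) * T k}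
           (λ k → sym (*-distribʳ-sum {d} (T k) (λ i → (ω ^ suc (toℕ k)) ^ toℕ i))) ⟩
    sum {d} (λ k → powerSum (ω ^ suc (toℕ k)) * T k)
      ≈⟨ sum-single (λ k → powerSum (ω ^ suc (toℕ k)) * T k) (F.fromℕ n) vanish ⟩
    powerSum (ω ^ suc (toℕ (F.fromℕ n))) * T (F.fromℕ n)
      ≡⟨ ≡.cong (λ e → powerSum (ω ^ suc e) * x ^ (q ℕ.^ (n ℕ.∸ e))) (FP.toℕ-fromℕ n) ⟩
    powerSum (ω ^ d) * x ^ (q ℕ.^ (n ℕ.∸ n))
      ≡⟨ ≡.cong (λ e → powerSum (ω ^ d) * x ^ (q ℕ.^ e)) (ℕ.n∸n≡0 n) ⟩
    powerSum (ω ^ d) * (x ^ 1)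
      ≈⟨ *-cong (trans (sum-cong {d} (λ i → ^-congˡ (toℕ i) ωᵈ≈1)) powerSum-1) (*-identityʳ x) ⟩
    (d ⊗ 1#) * x
      ∎
    where
      T : Fin d → Carrier
      T k = x ^ (q ℕ.^ (n ℕ.∸ toℕ k))
      expand : ∀ (i : Fin d) → ω ^ toℕ i * A (toℕ i) x ≈ sum {d} (λ k → (ω ^ suc (toℕ k)) ^ toℕ i * T k)
      expand i = trans (*-distribˡ-sum {d} (ω ^ toℕ i) (λ k → ω ^ (toℕ i ℕ.* toℕ k) * T k))
                       (sum-cong {d} (λ k → trans (sym (*-assoc (ω ^ toℕ i) (ω ^ (toℕ i ℕ.* toℕ k)) (T k))) (*-congʳ (begin
                         ω ^ toℕ i * ω ^ (toℕ i ℕ.* toℕ k)   ≈⟨ sym (^-homo-* ω (toℕ i) _) ⟩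
                         ω ^ (toℕ i ℕ.+ toℕ i ℕ.* toℕ k)    ≡⟨ ≡.cong (ω ^_) (≡.trans (≡.sym (ℕ.*-suc (toℕ i) (toℕ k))) (ℕ.*-comm (toℕ i) (suc (toℕ k)))) ⟩
                         ω ^ (suc (toℕ k) ℕ.* toℕ i)        ≈⟨ sym (^-assocʳ ω (suc (toℕ k)) (toℕ i)) ⟩
                         (ω ^ suc (toℕ k)) ^ toℕ i          ∎))))
      vanish : ∀ k → k ≢ F.fromℕ n → powerSum (ω ^ suc (toℕ k)) * T k ≈ 0#
      vanish k k≢n = trans (*-congʳ (powerSum-ωˢ (suc (toℕ k)) (ℕ.s≤s ℕ.z≤n) (ℕ.s≤s k<n))) (zeroˡ _)
        where
          k<n : toℕ k ℕ.< n
          k<n = ℕ.≤∧≢⇒< (ℕ.≤-pred (FP.toℕ<n k)) (λ e → k≢n (FP.toℕ-injective (≡.trans e (≡.sym (FP.toℕ-fromℕ n)))))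

  -- A nonzero ωˢ-eigenvector c has c^(q-1) = ωˢ, so a Bézout relation x m = 1 + y (q-1)
  -- (or its mirror image) recovers c from c^m up to a factor depending only on s.
  ^-injective-on-Eigen : ∀ s {a b} m → 1 ℕ.≤ m → gcd m q-1 ≡ 1 → Eigen s a → Eigen s b → a ^ m ≈ b ^ m → a ≈ b
  ^-injective-on-Eigen s {a} {b} m 1≤m gcd≡1 eigen-a eigen-b aᵐ≈bᵐ with a ≟ 0# | b ≟ 0#
  ... | yes a≈0 | yes b≈0 = trans a≈0 (sym b≈0)
  ... | yes a≈0 | no  b≉0 = ⊥-elim (^-≉0 m b≉0 (trans (sym aᵐ≈bᵐ) (^-≈0 m 1≤m a≈0)))
  ... | no  a≉0 | yes b≈0 = ⊥-elim (^-≉0 m a≉0 (trans aᵐ≈bᵐ (^-≈0 m 1≤m b≈0)))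
  ... | no  a≉0 | no  b≉0 with coprime-Bézout (gcd≡1⇒coprime gcd≡1)
  ...   | Bézout.+- x y 1+y*[q-1]≡x*m =
    *-cancelʳ (^-≉0 y (^-≉0 s ω≉0)) (trans (sym (recover a eigen-a a≉0)) (trans (^-congˡ x aᵐ≈bᵐ) (recover b eigen-b b≉0)))
    where
      recover : ∀ c → Eigen s c → ¬ c ≈ 0# → (c ^ m) ^ x ≈ c * (ω ^ s) ^ y
      recover c eigen-c c≉0 = begin
        (c ^ m) ^ x              ≈⟨ sym (^-* c x m) ⟩
        c ^ (x ℕ.* m)            ≡⟨ ≡.cong (c ^_) (≡.sym 1+y*[q-1]≡x*m) ⟩
        c ^ (1 ℕ.+ y ℕ.* q-1)    ≈⟨ *-congˡ (^-* c y q-1) ⟩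
        c * (c ^ q-1) ^ y        ≈⟨ *-congˡ (^-congˡ y (Eigen-^[q-1] {s} eigen-c c≉0)) ⟩
        c * (ω ^ s) ^ y          ∎
  ...   | Bézout.-+ x y 1+x*m≡y*[q-1] =
    *-cancelʳ (^-≉0 x (^-≉0 m a≉0)) (trans (recover a eigen-a a≉0) (trans (sym (recover b eigen-b b≉0)) (*-congˡ (^-congˡ x (sym aᵐ≈bᵐ)))))
    where
      recover : ∀ c → Eigen s c → ¬ c ≈ 0# → c * (c ^ m) ^ x ≈ (ω ^ s) ^ y
      recover c eigen-c c≉0 = begin
        c * (c ^ m) ^ x          ≈⟨ *-congˡ (sym (^-* c x m)) ⟩
        c ^ (1 ℕ.+ x ℕ.* m)      ≡⟨ ≡.cong (c ^_) 1+x*m≡y*[q-1] ⟩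
        c ^ (y ℕ.* q-1)          ≈⟨ ^-* c y q-1 ⟩
        (c ^ q-1) ^ y            ≈⟨ ^-congˡ y (Eigen-^[q-1] {s} eigen-c c≉0) ⟩
        (ω ^ s) ^ y              ∎

  ^m^r≈id-on-Eigen : ∀ s {a} m r → Eigen s a → (d ℕ.* q-1) ∣ (m ℕ.* r ℕ.∸ 1) → 0 ℕ.< m → 0 ℕ.< r → (a ^ m) ^ r ≈ a
  ^m^r≈id-on-Eigen s {a} m r eigen (divides t m*r∸1≡t*[d*[q-1]]) 0<m 0<r =
    trans (^-assocʳ a m r) (≡.subst (λ e → a ^ e ≈ a) (≡.sym m*r≡1+t*[d*[q-1]]) a^[1+t*[d*[q-1]]]≈a)
    where
      m*r≡1+t*[d*[q-1]] : m ℕ.* r ≡ suc (t ℕ.* (d ℕ.* q-1))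
      m*r≡1+t*[d*[q-1]] = ≡.trans (≡.sym (ℕ.suc-pred (m ℕ.* r) {{ℕ.>-nonZero (ℕ.*-mono-≤ 0<m 0<r)}})) (≡.cong suc m*r∸1≡t*[d*[q-1]])
      a^[1+t*[d*[q-1]]]≈a : a ^ suc (t ℕ.* (d ℕ.* q-1)) ≈ a
      a^[1+t*[d*[q-1]]]≈a with a ≟ 0#
      ... | yes a≈0 = trans (^-≈0 (suc (t ℕ.* (d ℕ.* q-1))) (ℕ.s≤s ℕ.z≤n) a≈0) (sym a≈0)
      ... | no  a≉0 = begin
        a * a ^ (t ℕ.* (d ℕ.* q-1))     ≈⟨ *-congˡ (^-* a t (d ℕ.* q-1)) ⟩
        a * (a ^ (d ℕ.* q-1)) ^ t       ≈⟨ *-congˡ (^-congˡ t (trans (^-* a d q-1) (trans (^-congˡ d (Eigen-^[q-1] {s} eigen a≉0)) ([ωᵃ]ᵈ≈1 s)))) ⟩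
        a * 1# ^ t                      ≈⟨ *-congˡ (1^n≈1 t) ⟩
        a * 1#                          ≈⟨ *-identityʳ a ⟩
        a                               ∎

  -- Aⱼ is a polynomial of degree qⁿ < N with leading coefficient 1, so it has a nonroot x.
  ∃-eigenvector : ∀ j → Σ Carrier λ v → Eigen j v × ¬ v ≈ 0#
  ∃-eigenvector j with ∃-nonroot A-poly leading≉0 (ℕ.^-monoʳ-< q 2≤q (ℕ.n<1+n n))
    where
      lead : Fin d → Carrier
      lead F.zero    = ω ^ (j ℕ.* 0) * 1#
      lead (F.suc k) = ω ^ (j ℕ.* suc (toℕ k)) * 0#
      term-poly : ∀ k → Poly (q ℕ.^ n) (λ x → ω ^ (j ℕ.* toℕ k) * x ^ (q ℕ.^ (n ℕ.∸ toℕ k))) (lead k)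
      term-poly F.zero    = pscale (ω ^ (j ℕ.* 0)) (monomial (q ℕ.^ n))
      term-poly (F.suc k) = pscale (ω ^ (j ℕ.* suc (toℕ k)))
        (raise (ℕ.^-monoʳ-< q 2≤q (ℕ.∸-monoʳ-< {n} {suc (toℕ k)} {0} (ℕ.s≤s ℕ.z≤n) (FP.toℕ<n k))) (monomial _))
      A-poly : Poly (q ℕ.^ n) (A j) (sum lead)
      A-poly = Poly-sum (λ k x → ω ^ (j ℕ.* toℕ k) * x ^ (q ℕ.^ (n ℕ.∸ toℕ k))) lead term-poly
      leading≉0 : ¬ sum lead ≈ 0#
      leading≉0 = 1≉0 ∘ trans (sym (trans (+-cong (trans (*-identityʳ _) (^-congʳ ω (ℕ.*-zeroʳ j)))
                                                  (sum-≈0 (λ k → lead (F.suc k)) (λ k → zeroʳ _)))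
                                           (+-identityʳ 1#)))
  ... | x , Aⱼx≉0 = A j x , A-Eigen j x , Aⱼx≉0


  N≡1+M*g : ∀ {g} → g ∣ q-1 → Σ ℕ λ M → 1 ℕ.≤ M × N ≡ suc (M ℕ.* g)
  N≡1+M*g g∣q-1 with [1+a]^t≡1+M*g d (ℕ.s≤s ℕ.z≤n) (ℕ.∸-monoˡ-≤ 1 2≤q) g∣q-1
  ... | M , 1≤M , qᵈ≡1+M*g = M , 1≤M , ≡.trans (≡.cong (ℕ._^ d) q≡1+[q-1]) qᵈ≡1+M*g

  private
    X^[M+1]-X : ∀ M → 1 ℕ.≤ M → Poly (suc M) (λ x → x ^ suc M + (- 1#) * x ^ 1) (1# + (- 1#) * 0#)
    X^[M+1]-X M 1≤M = padd (monomial (suc M)) (pscale (- 1#) (raise (ℕ.s≤s 1≤M) (monomial 1)))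

    1-0≉0 : ¬ (1# + (- 1#) * 0#) ≈ 0#
    1-0≉0 = 1≉0 ∘ trans (sym (trans (+-congˡ (zeroʳ _)) (+-identityʳ 1#)))

  -- With N = 1 + M g, some a is not a root of x^(M+1) - x (degree M + 1 < N); then ζ = aᴹ works.
  ∃-nontrivial-root-of-unity : ∀ g → 2 ℕ.≤ g → g ∣ q-1 → Σ Carrier λ ζ → ζ ^ g ≈ 1# × ¬ ζ ≈ 1#
  ∃-nontrivial-root-of-unity g 2≤g g∣q-1 with N≡1+M*g g∣q-1
  ... | M , 1≤M , N≡1+Mg with ∃-nonroot (X^[M+1]-X M 1≤M) 1-0≉0
                                 (≡.subst (suc M ℕ.<_) (≡.sym N≡1+Mg)
                                   (ℕ.s≤s (ℕ.<-≤-trans (ℕ.m<m*n M 2 {{ℕ.>-nonZero 1≤M}} (ℕ.s≤s (ℕ.s≤s ℕ.z≤n))) (ℕ.*-monoʳ-≤ M 2≤g))))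
  ... | a , a-nonroot = a ^ M , ζᵍ≈1 , ζ≉1
    where
      root-if : (a ^ suc M ≈ a) → a ^ suc M + (- 1#) * a ^ 1 ≈ 0#
      root-if aᴹ⁺¹≈a = trans (+-cong aᴹ⁺¹≈a (trans (-1*x≈-x _) (-‿cong (*-identityʳ a)))) (-‿inverseʳ a)
      a≉0 : ¬ a ≈ 0#
      a≉0 a≈0 = a-nonroot (root-if (trans (^-≈0 (suc M) (ℕ.s≤s ℕ.z≤n) a≈0) (sym a≈0)))
      ζ≉1 : ¬ a ^ M ≈ 1#
      ζ≉1 aᴹ≈1 = a-nonroot (root-if (trans (*-congˡ aᴹ≈1) (*-identityʳ a)))
      ζᵍ≈1 : (a ^ M) ^ g ≈ 1#
      ζᵍ≈1 = trans (^-assocʳ a M g) (*-cancelˡ a≉0 (begin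
        a * a ^ (M ℕ.* g)   ≡⟨ ≡.cong (a ^_) N≡1+Mg ⟨
        a ^ N               ≈⟨ x^N≈x a ⟩
        a                   ≈⟨ sym (*-identityʳ a) ⟩
        a * 1#              ∎))

  module PermutationCriterion (q%d≡1 : q % d ≡ 1)
    (m : Fin d → ℕ) (0<m : ∀ i → 0 ℕ.< m i) (u : Fin d → Carrier) (u∈Fq : ∀ i → u i ^ q ≈ u i) where

    f : Carrier → Carrier
    f = fpoly K q d ω m u

    f-cong : ∀ {x y} → x ≈ y → f x ≈ f y
    f-cong {x} {y} x≈y = sum-cong {d} {g = λ i → u i * A (toℕ i) y ^ m i} (λ i → *-congˡ (^-congˡ (m i) (A-cong (toℕ i) x≈y)))

    term : Fin d → Carrier → Carrier
    term i x = u i * A (toℕ i) x ^ m i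

    term-Eigen : ∀ i x → Eigen (toℕ i ℕ.* m i) (term i x)
    term-Eigen i x = Eigen-scale {toℕ i ℕ.* m i} (u∈Fq i) (Eigen-^ {toℕ i} (A-Eigen (toℕ i) x) (m i))

    A-f : ∀ j x → A j (f x) ≈ sum {d} (λ i → homSum (ω ^ j) (ω ^ (toℕ i ℕ.* m i)) n * term i x)
    A-f j x = trans (A-sum j {d} (λ i → term i x)) (sum-cong {d} (λ i → A-on-Eigen j (toℕ i ℕ.* m i) (term-Eigen i x)))

    J : Fin d → Fin d
    J i = (toℕ i ℕ.* m i) mod d

    ω^J≈ω^[i*mᵢ] : ∀ i → ω ^ toℕ (J i) ≈ ω ^ (toℕ i ℕ.* m i)
    ω^J≈ω^[i*mᵢ] i = trans (^-congʳ ω (FP.toℕ-fromℕ< (m%n<n (toℕ i ℕ.* m i) d))) (sym (ωᵃ≈ω^[a%d] (toℕ i ℕ.* m i)))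

    ω^j≈ω^[i*mᵢ]⇒j≡J : ∀ j i → ω ^ toℕ j ≈ ω ^ (toℕ i ℕ.* m i) → j ≡ J i
    ω^j≈ω^[i*mᵢ]⇒j≡J j i eq = FP.toℕ-injective (ω^-injective (FP.toℕ<n j) (FP.toℕ<n (J i)) (trans eq (sym (ω^J≈ω^[i*mᵢ] i))))

    coeff : ℕ → Carrier
    coeff j = d ⊗ (ω ^ j) ^ n

    coeff≉0 : ∀ j → ¬ coeff j ≈ 0#
    coeff≉0 j eq = *-≉0 (d×1≉0 q%d≡1) (^-≉0 n (^-≉0 j ω≉0)) (trans (sym (×≈×1* d _)) eq)

    A-J-f : (∀ {i i′} → J i ≡ J i′ → i ≡ i′) → ∀ i x → A (toℕ (J i)) (f x) ≈ coeff (toℕ (J i)) * term i x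
    A-J-f J-injective i₀ x =
      trans (A-f (toℕ (J i₀)) x)
            (trans (sum-single (λ i → homSum (ω ^ toℕ (J i₀)) (ω ^ (toℕ i ℕ.* m i)) n * term i x) i₀ off-diagonal)
                   (*-congʳ (homSum-ω-≈ (toℕ (J i₀)) (toℕ i₀ ℕ.* m i₀) (ω^J≈ω^[i*mᵢ] i₀))))
      where
        off-diagonal : ∀ i → i ≢ i₀ → homSum (ω ^ toℕ (J i₀)) (ω ^ (toℕ i ℕ.* m i)) n * term i x ≈ 0#
        off-diagonal i i≢i₀ = trans (*-congʳ (homSum-ω-≉ (toℕ (J i₀)) (toℕ i ℕ.* m i)
          (λ eq → i≢i₀ (J-injective (≡.sym (ω^j≈ω^[i*mᵢ]⇒j≡J (J i₀) i eq)))))) (zeroˡ _)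

    A-f≈0-outside-J : ∀ j → (∀ i → J i ≢ j) → ∀ x → A (toℕ j) (f x) ≈ 0#
    A-f≈0-outside-J j j∉J x = trans (A-f (toℕ j) x)
      (sum-≈0 (λ i → homSum (ω ^ toℕ j) (ω ^ (toℕ i ℕ.* m i)) n * term i x)
        (λ i → trans (*-congʳ (homSum-ω-≉ (toℕ j) (toℕ i ℕ.* m i) (λ eq → j∉J i (≡.sym (ω^j≈ω^[i*mᵢ]⇒j≡J j i eq))))) (zeroˡ _)))

    f-injective : (∀ {i i′} → J i ≡ J i′ → i ≡ i′) → (∀ i → ¬ u i ≈ 0#) → gcd (∏ℕ m) q-1 ≡ 1 →
                  ∀ {x x′} → f x ≈ f x′ → x ≈ x′
    f-injective J-injective u≉0 gcd≡1 {x} {x′} fx≈fx′ = *-cancelˡ (d×1≉0 q%d≡1) (begin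
      (d ⊗ 1#) * x                               ≈⟨ sym (∑ωⁱAᵢ≈d*x x) ⟩
      sum {d} (λ i → ω ^ toℕ i * A (toℕ i) x)
        ≈⟨ sum-cong {d} {g = λ i → ω ^ toℕ i * A (toℕ i) x′} (λ i → *-congˡ (Aᵢx≈Aᵢx′ i)) ⟩
      sum {d} (λ i → ω ^ toℕ i * A (toℕ i) x′)    ≈⟨ ∑ωⁱAᵢ≈d*x x′ ⟩
      (d ⊗ 1#) * x′                              ∎)
      where
        Aᵢx≈Aᵢx′ : ∀ i → A (toℕ i) x ≈ A (toℕ i) x′
        Aᵢx≈Aᵢx′ i = ^-injective-on-Eigen (toℕ i) (m i) (0<m i) (gcd≡1-∣ (∣∏ℕ m i) gcd≡1)
          (A-Eigen (toℕ i) x) (A-Eigen (toℕ i) x′)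
          (*-cancelˡ (u≉0 i) (*-cancelˡ (coeff≉0 (toℕ (J i)))
            (trans (sym (A-J-f J-injective i x)) (trans (A-cong (toℕ (J i)) fx≈fx′) (A-J-f J-injective i x′)))))

    sufficient : CompleteResidueSystem d (λ i → toℕ i ℕ.* m i) → ¬ product u ≈ 0# → gcd (∏ℕ m) q-1 ≡ 1 →
                 IsPermutation K f
    sufficient (J-injective , _) ∏u≉0 gcd≡1 = injective , injective⇒surjective f f-cong injective
      where
        injective : ∀ {x x′} → f x ≈ f x′ → x ≈ x′
        injective = f-injective J-injective (λ i uᵢ≈0 → ∏u≉0 (product-≈0 u i uᵢ≈0)) gcd≡1

    f-on-Eigen : ∀ i {y} → Eigen (toℕ i) y → f y ≈ u i * (homSum (ω ^ toℕ i) (ω ^ toℕ i) n * y) ^ m i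
    f-on-Eigen i {y} eigen =
      trans (sum-single (λ k → u k * A (toℕ k) y ^ m k) i off-diagonal)
            (*-congˡ (^-congˡ (m i) (A-on-Eigen (toℕ i) (toℕ i) eigen)))
      where
        off-diagonal : ∀ k → k ≢ i → u k * A (toℕ k) y ^ m k ≈ 0#
        off-diagonal k k≢i = trans (*-congˡ (^-≈0 (m k) (0<m k) (begin
          A (toℕ k) y                              ≈⟨ A-on-Eigen (toℕ k) (toℕ i) eigen ⟩
          homSum (ω ^ toℕ k) (ω ^ toℕ i) n * y     ≈⟨ *-congʳ (homSum-ω-≉ (toℕ k) (toℕ i) ωᵏ≉ωⁱ) ⟩
          0# * y                                   ≈⟨ zeroˡ y ⟩
          0#                                       ∎))) (zeroʳ _)
          where
            ωᵏ≉ωⁱ : ¬ ω ^ toℕ k ≈ ω ^ toℕ i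
            ωᵏ≉ωⁱ eq = k≢i (FP.toℕ-injective (ω^-injective (FP.toℕ<n k) (FP.toℕ<n i) eq))

    f-0 : f 0# ≈ 0#
    f-0 = sum-≈0 {d} (λ k → u k * A (toℕ k) 0# ^ m k) (λ k → trans (*-congˡ (^-≈0 (m k) (0<m k) (A-0 (toℕ k)))) (zeroʳ _))

    necessary-u : IsPermutation K f → ∀ i → ¬ u i ≈ 0#
    necessary-u (injective , _) i uᵢ≈0 with ∃-eigenvector (toℕ i)
    ... | v , eigen , v≉0 = v≉0 (injective (trans fv≈0 (sym f-0)))
      where
        fv≈0 : f v ≈ 0#
        fv≈0 = trans (f-on-Eigen i eigen) (trans (*-congʳ uᵢ≈0) (zeroˡ _))

    J-surjective : IsPermutation K f → ∀ j → Σ (Fin d) λ i → J i ≡ j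
    J-surjective (_ , surjective) j with FP.any? (λ i → J i FP.≟ j)
    ... | yes hit = hit
    ... | no  miss with ∃-eigenvector (toℕ j)
    ...   | v , eigen , v≉0 with surjective v
    ...     | x , fx≈v = ⊥-elim (*-≉0 (coeff≉0 (toℕ j)) v≉0 (begin
      coeff (toℕ j) * v                          ≈⟨ *-congʳ (homSum-ω-≈ (toℕ j) (toℕ j) refl) ⟨
      homSum (ω ^ toℕ j) (ω ^ toℕ j) n * v       ≈⟨ A-on-Eigen (toℕ j) (toℕ j) eigen ⟨
      A (toℕ j) v                                ≈⟨ A-cong (toℕ j) (fx≈v refl) ⟨
      A (toℕ j) (f x)                            ≈⟨ A-f≈0-outside-J j (λ i Jᵢ≡j → miss (i , Jᵢ≡j)) x ⟩
      0#                                         ∎))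

    necessary-residues : IsPermutation K f → CompleteResidueSystem d (λ i → toℕ i ℕ.* m i)
    necessary-residues perm =
      Fin-surjective⇒injective J (J-surjective perm) ,
      λ j → let i , Jᵢ≡j = J-surjective perm j in i , λ z≡i → ≡.trans (≡.cong J z≡i) Jᵢ≡j

    f-invariant : ∀ i {ζ v} → ζ ^ q ≈ ζ → ζ ^ m i ≈ 1# → Eigen (toℕ i) v → f (ζ * v) ≈ f v
    f-invariant i {ζ} {v} ζ∈Fq ζᵐ≈1 eigen = begin
      f (ζ * v)                         ≈⟨ f-on-Eigen i (Eigen-scale {toℕ i} ζ∈Fq eigen) ⟩
      u i * (h * (ζ * v)) ^ m i         ≈⟨ *-congˡ (^-congˡ (m i) (x∙yz≈y∙xz h ζ v)) ⟩
      u i * (ζ * (h * v)) ^ m i         ≈⟨ *-congˡ (^-distrib-* ζ (h * v) (m i)) ⟩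
      u i * (ζ ^ m i * (h * v) ^ m i)   ≈⟨ *-congˡ (*-congʳ ζᵐ≈1) ⟩
      u i * (1# * (h * v) ^ m i)        ≈⟨ *-congˡ (*-identityˡ _) ⟩
      u i * (h * v) ^ m i               ≈⟨ f-on-Eigen i eigen ⟨
      f v                               ∎
      where h = homSum (ω ^ toℕ i) (ω ^ toℕ i) n

    -- ζ lies in F_q because g ∣ q - 1.
    no-common-divisor : IsPermutation K f → ∀ i g → 2 ℕ.≤ g → g ∣ m i → g ∣ q-1 → ⊥
    no-common-divisor (injective , _) i g 2≤g g∣mᵢ g∣q-1 =
      let ζ , ζᵍ≈1 , ζ≉1 = ∃-nontrivial-root-of-unity g 2≤g g∣q-1
          v , eigen , v≉0 = ∃-eigenvector (toℕ i)
          ζ∈Fq = trans (^-congʳ ζ q≡1+[q-1]) (trans (*-congˡ (xᵍ≈1⇒xᵉ≈1 ζᵍ≈1 g∣q-1)) (*-identityʳ ζ))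
          fζv≈fv = f-invariant i ζ∈Fq (xᵍ≈1⇒xᵉ≈1 ζᵍ≈1 g∣mᵢ) eigen
      in ζ≉1 (*-cancelʳ v≉0 (trans (injective fζv≈fv) (sym (*-identityˡ v))))

    necessary-gcdᵢ : IsPermutation K f → ∀ i → gcd (m i) q-1 ≡ 1
    necessary-gcdᵢ perm i with gcd (m i) q-1 ℕ.≟ 1
    ... | yes gcd≡1 = gcd≡1
    ... | no  gcd≢1 = ⊥-elim (no-common-divisor perm i _ 2≤gcd (gcd[m,n]∣m (m i) q-1) (gcd[m,n]∣n (m i) q-1))
      where
        2≤gcd : 2 ℕ.≤ gcd (m i) q-1
        2≤gcd = ℕ.≤∧≢⇒< (ℕ.n≢0⇒n>0 λ gcd≡0 → ℕ.<⇒≢ (ℕ.∸-monoˡ-≤ 1 2≤q) (≡.sym (gcd[m,n]≡0⇒n≡0 (m i) gcd≡0)))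
                        (λ 1≡gcd → gcd≢1 (≡.sym 1≡gcd))

    necessary-gcd : IsPermutation K f → gcd (∏ℕ m) q-1 ≡ 1
    necessary-gcd perm = coprime⇒gcd≡1 (coprime-∏ℕ m (λ i → gcd≡1⇒coprime (necessary-gcdᵢ perm i)))

    module CompositionalInverse (perm : IsPermutation K f) (r : Fin d → ℕ) (0<r : ∀ i → 0 ℕ.< r i)
      (d*[q-1]∣mr-1 : ∀ i → (d ℕ.* q-1) ∣ (m i ℕ.* r i ℕ.∸ 1)) where

      f⁻¹ : Carrier → Carrier
      f⁻¹ = finvpoly K q d ω m u r

      β : Fin d → Carrier
      β i = ((d ⊗ 1#) * u i) * (ω ⁻¹) ^ toℕ (J i)

      β≉0 : ∀ i → ¬ β i ≈ 0#
      β≉0 i = *-≉0 (*-≉0 (d×1≉0 q%d≡1) (necessary-u perm i)) (^-≉0 (toℕ (J i)) (⁻¹-≉0 ω≉0))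

      f⁻¹-cong : ∀ {x y} → x ≈ y → f⁻¹ x ≈ f⁻¹ y
      f⁻¹-cong {x} {y} x≈y = *-congˡ (sum-cong {d} {g = λ i → (ω ^ toℕ i * (β i ⁻¹) ^ r i) * A (toℕ (J i)) y ^ r i}
                                      (λ i → *-congˡ (^-congˡ (r i) (A-cong (toℕ (J i)) x≈y))))

      A-J-f≈β*Aᵐ : ∀ i y → A (toℕ (J i)) (f y) ≈ β i * A (toℕ i) y ^ m i
      A-J-f≈β*Aᵐ i y = begin
        A (toℕ (J i)) (f y)                                  ≈⟨ A-J-f (proj₁ (necessary-residues perm)) i y ⟩
        coeff (toℕ (J i)) * (u i * A (toℕ i) y ^ m i)        ≈⟨ *-congʳ (trans (×≈×1* d _) (*-congˡ ([ωʲ]ⁿ≈[ω⁻¹]ʲ (toℕ (J i))))) ⟩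
        ((d ⊗ 1#) * (ω ⁻¹) ^ toℕ (J i)) * (u i * A (toℕ i) y ^ m i)
                                                             ≈⟨ rearrange (d ⊗ 1#) (u i) ((ω ⁻¹) ^ toℕ (J i)) (A (toℕ i) y ^ m i) ⟩
        β i * A (toℕ i) y ^ m i                              ∎
        where
          rearrange : ∀ a b c e → (a * c) * (b * e) ≈ ((a * b) * c) * e
          rearrange a b c e = trans (interchange a c b e) (sym (*-assoc (a * b) c e))

      f⁻¹∘f≈id : ∀ y → f⁻¹ (f y) ≈ y
      f⁻¹∘f≈id y = begin
        (d ⊗ 1#) ⁻¹ * sum {d} (λ i → (ω ^ toℕ i * (β i ⁻¹) ^ r i) * A (toℕ (J i)) (f y) ^ r i)
          ≈⟨ *-congˡ (sum-cong {d} {g = λ i → ω ^ toℕ i * A (toℕ i) y} undo) ⟩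
        (d ⊗ 1#) ⁻¹ * sum {d} (λ i → ω ^ toℕ i * A (toℕ i) y)
          ≈⟨ *-congˡ (∑ωⁱAᵢ≈d*x y) ⟩
        (d ⊗ 1#) ⁻¹ * ((d ⊗ 1#) * y)   ≈⟨ *-assoc _ _ _ ⟨
        ((d ⊗ 1#) ⁻¹ * (d ⊗ 1#)) * y   ≈⟨ *-congʳ (⁻¹-inverseˡ _ (d×1≉0 q%d≡1)) ⟩
        1# * y                         ≈⟨ *-identityˡ y ⟩
        y                              ∎
        where
          undo : ∀ i → (ω ^ toℕ i * (β i ⁻¹) ^ r i) * A (toℕ (J i)) (f y) ^ r i ≈ ω ^ toℕ i * A (toℕ i) y
          undo i = begin
            (ω ^ toℕ i * (β i ⁻¹) ^ r i) * A (toℕ (J i)) (f y) ^ r i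
              ≈⟨ *-congˡ (^-congˡ (r i) (A-J-f≈β*Aᵐ i y)) ⟩
            (ω ^ toℕ i * (β i ⁻¹) ^ r i) * (β i * a ^ m i) ^ r i
              ≈⟨ *-assoc _ _ _ ⟩
            ω ^ toℕ i * ((β i ⁻¹) ^ r i * (β i * a ^ m i) ^ r i)
              ≈⟨ *-congˡ (^-distrib-* _ _ (r i)) ⟨
            ω ^ toℕ i * (β i ⁻¹ * (β i * a ^ m i)) ^ r i
              ≈⟨ *-congˡ (^-congˡ (r i) β⁻¹*[β*aᵐ]≈aᵐ) ⟩
            ω ^ toℕ i * (a ^ m i) ^ r i
              ≈⟨ *-congˡ (^m^r≈id-on-Eigen (toℕ i) (m i) (r i) (A-Eigen (toℕ i) y) (d*[q-1]∣mr-1 i) (0<m i) (0<r i)) ⟩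
            ω ^ toℕ i * a
              ∎
            where
              a = A (toℕ i) y
              β⁻¹*[β*aᵐ]≈aᵐ : β i ⁻¹ * (β i * a ^ m i) ≈ a ^ m i
              β⁻¹*[β*aᵐ]≈aᵐ = trans (sym (*-assoc _ _ _)) (trans (*-congʳ (⁻¹-inverseˡ (β i) (β≉0 i))) (*-identityˡ _))

      f∘f⁻¹≈id : ∀ x → f (f⁻¹ x) ≈ x
      f∘f⁻¹≈id x with proj₂ perm x
      ... | y , fy≈x = fy≈x (trans (f⁻¹-cong (sym (fy≈x refl))) (f⁻¹∘f≈id y))

theorem6p1 : ∀ {c ℓ} (K : Field c ℓ) (q d : ℕ) .{{_ : NonZero d}} →
  1 < d → IsPrimePower q → q % d ≡ 1 →
  Inverse (setoid (Fin (q ^ℕ d))) (Field.setoid K) →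
  (ω : Field.Carrier K) → InSubfield K q ω → PrimitiveRoot K d ω →
  (m : Fin d → ℕ) → (∀ i → 0 < m i) →
  (u : Fin d → Field.Carrier K) → (∀ i → InSubfield K q (u i)) →
  (IsPermutation K (fpoly K q d ω m u)
    ⇔ (CompleteResidueSystem d (λ i → toℕ i *ℕ m i)
       × ¬ (Field._≈_ K (Field.product K u) (Field.0# K))
       × gcd (∏ℕ m) (q ∸ 1) ≡ 1))
  × (IsPermutation K (fpoly K q d ω m u) →
     (r : Fin d → ℕ) → (∀ i → 0 < r i) →
     (∀ i → (d *ℕ (q ∸ 1)) ∣ (m i *ℕ r i ∸ 1)) →
     ∀ x → Field._≈_ K (finvpoly K q d ω m u r (fpoly K q d ω m u x)) x
         × Field._≈_ K (fpoly K q d ω m u (finvpoly K q d ω m u r x)) x)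
-- The argument works for every d ≥ 1.
theorem6p1 K q (suc n) _ (p , k , p-prime , 1≤k , q≡pᵏ) q%d≡1 enum ω ω∈Fq ω-primitive m 0<m u u∈Fq =
  mk⇔ (λ perm → necessary-residues perm , product-≉0 u (necessary-u perm) , necessary-gcd perm)
      (λ (residues , ∏u≉0 , gcd≡1) → sufficient residues ∏u≉0 gcd≡1) ,
  λ perm r 0<r d*[q-1]∣mr-1 x → let open CompositionalInverse perm r 0<r d*[q-1]∣mr-1 in f⁻¹∘f≈id x , f∘f⁻¹≈id x
  where
    open FieldProperties K using (product-≉0)
    open FrobeniusEigenspaces K p-prime 1≤k q≡pᵏ n enum ω∈Fq ω-primitive
    open PermutationCriterion q%d≡1 m 0<m u u∈Fq
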